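{- The equational validity problem for core-wMSO — given core-wMSO formulas $\Phi_1,\Phi_2$, decide whether $[\![\Phi_1]\!](w,\sigma)=[\![\Phi_2]\!](w,\sigma)$ for all pairs $(w,\sigma)$ — is decidable.
   Context: $R$ is a set of weights with decidable equality; $\Sigma$ a finite alphabet. MSO: $\varphi::=\top\mid P_a(x)\mid x\le y\mid x\in X\mid\neg\varphi\mid\varphi\wedge\varphi\mid\forall x.\varphi\mid\forall X.\varphi$, interpreted over $(w,\sigma)$ with $w\in\Sigma^+$ and $\sigma$ mapping first-order variables to positions and second-order variables to sets of positions. step-wMSO: $\Psi::=r\mid\varphi\,?\,\Psi_1:\Psi_2$, $[\![r]\!]=r$, conditional selects $\Psi_1$ if $\varphi$ holds, else $\Psi_2$. core-wMSO: $\Phi::=\mathbf{0}\mid\prod_x\Psi\mid\varphi\,?\,\Phi_1:\Phi_2\mid\Phi_1+\Phi_2\mid\sum_x\Phi\mid\sum_X\Phi$, with values finite multisets of words over $R$: $[\![\mathbf{0}]\!]=\emptyset$; $[\![\prod_x\Psi]\!](w,\sigma)$ the multiset with single word $r_1\cdots r_{|w|}$, $r_i=[\![\Psi]\!](w,\sigma[x\mapsto i])$; conditional selects by $\varphi$; $+$ is multiset union; $[\![\sum_x\Phi]\!](w,\sigma)=\biguplus_{i=1}^{|w|}[\![\Phi]\!](w,\sigma[x\mapsto i])$; $[\![\sum_X\Phi]\!](w,\sigma)=\biguplus_{I\subseteq\{1,\dots,|w|\}}[\![\Phi]\!](w,\sigma[X\mapsto I])$. -}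

module Defs where

open import Level using (Level)
open import Data.Bool using (Bool; true; false; not; _∧_; if_then_else_)
open import Data.Nat using (ℕ; zero; suc)
open import Data.Nat.Properties using () renaming (_≟_ to _≟ℕ_)
open import Data.Fin using (Fin) renaming (_≤?_ to _≤ᶠ?_)
open import Data.Fin.Properties using () renaming (_≟_ to _≟ᶠ_)
open import Data.Vec using (Vec; []; _∷_; lookup)
open import Data.List using (List; []; _∷_; map; _++_; concatMap; allFin)
open import Data.Bool.ListAction using (all)
open import Relation.Nullary.Decidable using (⌊_⌋)

-- Variables are named by natural numbers (first-order and second-order
-- variables live in separate namespaces).
FVar : Set
FVar = ℕ

SVar : Set
SVar = ℕ

data MSO (k : ℕ) : Set where
  ⊤ᶠ   : MSO k
  P    : Fin k → FVar → MSO k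
  _≤ᵥ_ : FVar → FVar → MSO k
  _∈ᵥ_ : FVar → SVar → MSO k
  ¬ᶠ_  : MSO k → MSO k
  _∧ᶠ_ : MSO k → MSO k → MSO k
  ∀¹   : FVar → MSO k → MSO k
  ∀²   : SVar → MSO k → MSO k

PosSet : ℕ → Set
PosSet n = Vec Bool n

allSubsets : (n : ℕ) → List (PosSet n)
allSubsets zero    = [] ∷ []
allSubsets (suc n) = map (false ∷_) (allSubsets n) ++ map (true ∷_) (allSubsets n)

-- Valuations σ (total; only values on free variables matter).
record Assignment (n : ℕ) : Set where
  constructor ⟨_,_⟩
  field
    fo : FVar → Fin n
    so : SVar → PosSet n
open Assignment public

_[_↦₁_] : ∀ {n} → Assignment n → FVar → Fin n → Assignment n
σ [ x ↦₁ i ] = ⟨ (λ y → if ⌊ y ≟ℕ x ⌋ then i else fo σ y) , so σ ⟩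

_[_↦₂_] : ∀ {n} → Assignment n → SVar → PosSet n → Assignment n
σ [ X ↦₂ I ] = ⟨ fo σ , (λ Y → if ⌊ Y ≟ℕ X ⌋ then I else so σ Y) ⟩

sat : ∀ {k n} → MSO k → Vec (Fin k) n → Assignment n → Bool
sat ⊤ᶠ        w σ = true
sat (P a x)   w σ = ⌊ lookup w (fo σ x) ≟ᶠ a ⌋
sat (x ≤ᵥ y)  w σ = ⌊ fo σ x ≤ᶠ? fo σ y ⌋
sat (x ∈ᵥ X)  w σ = lookup (so σ X) (fo σ x)
sat (¬ᶠ φ)    w σ = not (sat φ w σ)
sat (φ ∧ᶠ ψ)  w σ = sat φ w σ ∧ sat ψ w σ
sat {n = n} (∀¹ x φ) w σ = all (λ i → sat φ w (σ [ x ↦₁ i ])) (allFin n)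
sat {n = n} (∀² X φ) w σ = all (λ I → sat φ w (σ [ X ↦₂ I ])) (allSubsets n)

module _ {ℓ : Level} (R : Set ℓ) (k : ℕ) where

  data StepWMSO : Set ℓ where
    wt   : R → StepWMSO
    _⁇_∶_ : MSO k → StepWMSO → StepWMSO → StepWMSO

  data CoreWMSO : Set ℓ where
    𝟘     : CoreWMSO
    Π     : FVar → StepWMSO → CoreWMSO
    _⁇_∶_ : MSO k → CoreWMSO → CoreWMSO → CoreWMSO
    _⊕_   : CoreWMSO → CoreWMSO → CoreWMSO
    Σ¹    : FVar → CoreWMSO → CoreWMSO
    Σ²    : SVar → CoreWMSO → CoreWMSO

module _ {ℓ : Level} {R : Set ℓ} {k : ℕ} where

  ⟦_⟧ˢ : ∀ {n} → StepWMSO R k → Vec (Fin k) n → Assignment n → R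
  ⟦ wt r ⟧ˢ          w σ = r
  ⟦ φ ⁇ Ψ₁ ∶ Ψ₂ ⟧ˢ   w σ = if sat φ w σ then ⟦ Ψ₁ ⟧ˢ w σ else ⟦ Ψ₂ ⟧ˢ w σ

  -- Finite multisets of words over R are represented by lists of lists;
  -- multiset equality is list permutation (_↭_), multiset union is _++_.
  ⟦_⟧ : ∀ {n} → CoreWMSO R k → Vec (Fin k) n → Assignment n → List (List R)
  ⟦ 𝟘 ⟧             w σ = []
  ⟦_⟧ {n} (Π x Ψ)   w σ = map (λ i → ⟦ Ψ ⟧ˢ w (σ [ x ↦₁ i ])) (allFin n) ∷ []
  ⟦ φ ⁇ Φ₁ ∶ Φ₂ ⟧   w σ = if sat φ w σ then ⟦ Φ₁ ⟧ w σ else ⟦ Φ₂ ⟧ w σ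
  ⟦ Φ₁ ⊕ Φ₂ ⟧       w σ = ⟦ Φ₁ ⟧ w σ ++ ⟦ Φ₂ ⟧ w σ
  ⟦_⟧ {n} (Σ¹ x Φ)  w σ = concatMap (λ i → ⟦ Φ ⟧ w (σ [ x ↦₁ i ])) (allFin n)
  ⟦_⟧ {n} (Σ² X Φ)  w σ = concatMap (λ I → ⟦ Φ ⟧ w (σ [ X ↦₂ I ])) (allSubsets n)

-- A word w, an assignment σ of the variables that occur, and a word over the
-- weights of Φ₁ and Φ₂ are encoded together as one word over a finite alphabet
-- whose letters carry one bit per variable. Büchi's construction turns MSO
-- formulas into deterministic automata over these encodings, and the
-- constructs of core-wMSO become sums, Hadamard products with 0/1-automata and
-- sums over a bit track of ℚ-weighted automata: the automaton of Φ computes the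
-- multiplicity of the encoded output word in ⟦ Φ ⟧ w σ. Two multisets are equal
-- iff all multiplicities agree, so Φ₁ and Φ₂ are equivalent iff the difference
-- of their automata, restricted to valid encodings, is the zero series; and
-- Schützenberger's algorithm decides that by linear algebra over ℚ.

module Submission where

open import Defs
open import Level using (Level)
open import Data.Nat using (ℕ; suc)
open import Data.Fin using (Fin)
open import Data.Vec using (Vec)
open import Relation.Nullary using (Dec)
open import Relation.Binary.Definitions using (DecidableEquality)
open import Data.List.Relation.Binary.Permutation.Propositional using (_↭_)

open import Algebra.Structures using (IsCommutativeSemiring)
open import Data.List using (List)
open import Relation.Binary.PropositionalEquality using (_≡_)

module BitVectors where

  open import Data.Bool using (Bool; true; false; _∧_; if_then_else_)
  open import Data.Bool.Properties using () renaming (_≟_ to _≟ᵇ_)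
  open import Data.Empty using (⊥-elim)
  open import Data.Fin using (Fin; zero; suc)
  open import Data.List using (map)
  open import Data.List.Membership.Propositional using (_∈_)
  open import Data.List.Membership.Propositional.Properties using (∈-++⁺ˡ; ∈-++⁺ʳ; ∈-map⁺)
  open import Data.List.Relation.Unary.Any using (here)
  open import Data.Nat using (ℕ; zero; suc; _<_; z≤n; s≤s)
  open import Data.Nat.Properties using (suc-injective) renaming (_≟_ to _≟ℕ_)
  open import Data.Vec using (Vec; []; _∷_; replicate)
  open import Function using (_∘_)
  open import Relation.Binary.PropositionalEquality using (_≡_; refl; sym; trans; cong; cong₂)
  open import Relation.Nullary using (yes; no)
  open import Relation.Nullary.Decidable using (⌊_⌋)

  open import Defs using (allSubsets)

  infix 4 _==_
  _==_ : ∀ {n} → Vec Bool n → Vec Bool n → Bool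
  []      == []      = true
  (b ∷ p) == (c ∷ q) = ⌊ b ≟ᵇ c ⌋ ∧ (p == q)

  isEmpty : ∀ {n} → Vec Bool n → Bool
  isEmpty []          = true
  isEmpty (true ∷ b)  = false
  isEmpty (false ∷ b) = isEmpty b

  isSingleton : ∀ {n} → Vec Bool n → Bool
  isSingleton []          = false
  isSingleton (true ∷ b)  = isEmpty b
  isSingleton (false ∷ b) = isSingleton b

  singleton : ∀ {n} → Fin n → Vec Bool n
  singleton zero    = true ∷ replicate _ false
  singleton (suc i) = false ∷ singleton i

  ∈-allSubsets : ∀ {n} (v : Vec Bool n) → v ∈ allSubsets n
  ∈-allSubsets []                  = here refl
  ∈-allSubsets {suc n} (false ∷ v) = ∈-++⁺ˡ (∈-map⁺ (false ∷_) (∈-allSubsets v))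
  ∈-allSubsets {suc n} (true ∷ v)  = ∈-++⁺ʳ (map (false ∷_) (allSubsets n)) (∈-map⁺ (true ∷_) (∈-allSubsets v))

  isSingleton-singleton : ∀ {n} (i : Fin n) → isSingleton (singleton i) ≡ true
  isSingleton-singleton {suc n} zero = isEmpty-replicate n
    where
    isEmpty-replicate : ∀ n → isEmpty (replicate n false) ≡ true
    isEmpty-replicate zero    = refl
    isEmpty-replicate (suc n) = isEmpty-replicate n
  isSingleton-singleton (suc i) = isSingleton-singleton i

  -- The position of the first true bit; a junk position if there is none.
  position : ∀ {n} → Vec Bool (suc n) → Fin (suc n)
  position         (true ∷ b)  = zero
  position {zero}  (false ∷ b) = zero
  position {suc n} (false ∷ b) = suc (position b)

  singleton-position : ∀ {n} (b : Vec Bool (suc n)) → isSingleton b ≡ true → singleton (position b) ≡ b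
  singleton-position         (true ∷ b)  empty = cong (true ∷_) (replicate-isEmpty b empty)
    where
    replicate-isEmpty : ∀ {n} (b : Vec Bool n) → isEmpty b ≡ true → replicate n false ≡ b
    replicate-isEmpty []          _     = refl
    replicate-isEmpty (false ∷ b) empty = cong (false ∷_) (replicate-isEmpty b empty)
  singleton-position {zero}  (false ∷ []) ()
  singleton-position {suc n} (false ∷ b) one = cong (false ∷_) (singleton-position b one)

  bit : ∀ {n} → Vec Bool n → ℕ → Bool
  bit []      x       = false
  bit (b ∷ v) zero    = b
  bit (b ∷ v) (suc x) = bit v x

  bits : ∀ {n} → (ℕ → Bool) → Vec Bool n
  bits {zero}  g = []
  bits {suc n} g = g 0 ∷ bits (g ∘ suc)

  setBit : ∀ {n} → ℕ → Bool → Vec Bool n → Vec Bool n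
  setBit x       b []      = []
  setBit zero    b (c ∷ v) = b ∷ v
  setBit (suc x) b (c ∷ v) = c ∷ setBit x b v

  bit-bits : ∀ {n} (g : ℕ → Bool) x → x < n → bit (bits {n} g) x ≡ g x
  bit-bits g zero    (s≤s _)   = refl
  bit-bits g (suc x) (s≤s x<n) = bit-bits (g ∘ suc) x x<n

  bits-bit : ∀ {n} (v : Vec Bool n) → bits (bit v) ≡ v
  bits-bit []      = refl
  bits-bit (b ∷ v) = cong (b ∷_) (bits-bit v)

  bits-cong : ∀ {n} {f g : ℕ → Bool} → (∀ y → y < n → f y ≡ g y) → bits {n} f ≡ bits g
  bits-cong {zero}  f≗g = refl
  bits-cong {suc n} f≗g = cong₂ _∷_ (f≗g 0 (s≤s z≤n)) (bits-cong (λ y y<n → f≗g (suc y) (s≤s y<n)))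

  bit-setBit : ∀ {n} x b (v : Vec Bool n) → x < n → bit (setBit x b v) x ≡ b
  bit-setBit zero    b (c ∷ v) _         = refl
  bit-setBit (suc x) b (c ∷ v) (s≤s x<n) = bit-setBit x b v x<n

  setBit-bits : ∀ {n} x b (g : ℕ → Bool) → setBit x b (bits {n} g) ≡ bits (λ y → if ⌊ y ≟ℕ x ⌋ then b else g y)
  setBit-bits {zero}  x       b g = refl
  setBit-bits {suc n} zero    b g = refl
  setBit-bits {suc n} (suc x) b g =
    cong (g 0 ∷_) (trans (setBit-bits x b (g ∘ suc))
                         (bits-cong (λ y _ → cong (if_then b else g (suc y)) (sym (suc≟suc y x)))))
    where
    suc≟suc : ∀ y x → ⌊ suc y ≟ℕ suc x ⌋ ≡ ⌊ y ≟ℕ x ⌋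
    suc≟suc y x with y ≟ℕ x | suc y ≟ℕ suc x
    ... | yes _   | yes _    = refl
    ... | no  _   | no  _    = refl
    ... | yes y≡x | no  sy≢sx = ⊥-elim (sy≢sx (cong suc y≡x))
    ... | no  y≢x | yes sy≡sx = ⊥-elim (y≢x (suc-injective sy≡sx))


module DeterministicAutomata where

  open import Data.Bool using (Bool; true; false; _∧_; _∨_; not)
  open import Data.Bool.Properties using (∧-zeroʳ; ∨-identityʳ)
  open import Data.Empty using (⊥-elim)
  open import Data.Fin using (Fin; zero; suc; _≤?_)
  open import Data.List using (List; []; _∷_; foldl; tabulate)
  open import Data.Nat using (ℕ; zero; suc; s≤s)
  open import Data.Vec using (Vec; []; _∷_; lookup)
  import Data.Vec as Vec
  open import Data.Vec.Properties using (lookup-replicate; tabulate-cong; tabulate∘lookup)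
  open import Function using (_∘_)
  open import Relation.Binary.PropositionalEquality
  open import Relation.Nullary using (yes; no)
  open import Relation.Nullary.Decidable using (⌊_⌋)

  open BitVectors

  -- States are bit vectors so that every state space is enumerated by allSubsets,
  -- and the subset construction stays inside the class.
  record DFA (G : Set) : Set where
    field
      size      : ℕ
      start     : Vec Bool size
      next      : Vec Bool size → G → Vec Bool size
      accepting : Vec Bool size → Bool

    accepts : List G → Bool
    accepts u = accepting (foldl next start u)

  open DFA public

  complement : ∀ {G} → DFA G → DFA G
  complement D = record D { accepting = λ q → not (accepting D q) }

  everything : ∀ {G} → DFA G
  everything = record { size = 0 ; start = [] ; next = λ q _ → q ; accepting = λ _ → true }

  -- The word c with b written into one bit track: mark b a overwrites that track of the letter a.
  writeTrack : ∀ {G : Set} {N} → (Bool → G → G) → Vec Bool N → (Fin N → G) → List G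
  writeTrack mark b c = tabulate (λ j → mark (lookup b j) (c j))

  module _ {G : Set} (p h : G → Bool) where

    markedLetter : DFA G
    markedLetter = record
      { size      = 1
      ; start     = false ∷ []
      ; next      = λ { (s ∷ []) a → (s ∨ (p a ∧ h a)) ∷ [] }
      ; accepting = Vec.head }

    private
      run-markedLetter : ∀ {N} → Bool → (Fin N → G) → Bool
      run-markedLetter s c = accepting markedLetter (foldl (next markedLetter) (s ∷ []) (tabulate c))

      markedLetter-unmarked : ∀ s {N} (c : Fin N → G) → (∀ j → p (c j) ≡ false) → run-markedLetter s c ≡ s
      markedLetter-unmarked s {zero}  c unmarked = refl
      markedLetter-unmarked s {suc N} c unmarked = begin
        run-markedLetter (s ∨ (p (c zero) ∧ h (c zero))) (c ∘ suc)
          ≡⟨ cong (λ b → run-markedLetter (s ∨ (b ∧ h (c zero))) (c ∘ suc)) (unmarked zero) ⟩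
        run-markedLetter (s ∨ false) (c ∘ suc)
          ≡⟨ markedLetter-unmarked (s ∨ false) (c ∘ suc) (unmarked ∘ suc) ⟩
        s ∨ false                                                ≡⟨ ∨-identityʳ s ⟩
        s                                                        ∎
        where open ≡-Reasoning

    accepts-markedLetter : ∀ {N} (i : Fin N) c → (∀ j → p (c j) ≡ lookup (singleton i) j) →
                           accepts markedLetter (tabulate c) ≡ h (c i)
    accepts-markedLetter zero    c at-i =
      trans (cong (λ b → run-markedLetter (b ∧ h (c zero)) (c ∘ suc)) (at-i zero))
            (markedLetter-unmarked (h (c zero)) (c ∘ suc) (λ j → trans (at-i (suc j)) (lookup-replicate j false)))
    accepts-markedLetter (suc i) c at-i =
      trans (cong (λ b → run-markedLetter (b ∧ h (c zero)) (c ∘ suc)) (at-i zero))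
            (accepts-markedLetter i (c ∘ suc) (at-i ∘ suc))

  module _ {G : Set} (q : G → Bool) where

    -- the state records (seen one q-letter, seen two)
    exactlyOne : DFA G
    exactlyOne = record
      { size      = 2
      ; start     = false ∷ false ∷ []
      ; next      = λ { (s ∷ f ∷ []) a → (s ∨ q a) ∷ (f ∨ (s ∧ q a)) ∷ [] }
      ; accepting = λ { (s ∷ f ∷ []) → s ∧ not f } }

    private
      run-exactlyOne : ∀ {N} → Vec Bool 2 → (Fin N → G) → Bool
      run-exactlyOne q₀ c = accepting exactlyOne (foldl (next exactlyOne) q₀ (tabulate c))

      exactlyOne-failed : ∀ s {N} (c : Fin N → G) → run-exactlyOne (s ∷ true ∷ []) c ≡ false
      exactlyOne-failed true  {zero}  c = refl
      exactlyOne-failed false {zero}  c = refl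
      exactlyOne-failed s     {suc N} c = exactlyOne-failed (s ∨ q (c zero)) (c ∘ suc)

      exactlyOne-seen : ∀ {N} (c : Fin N → G) → run-exactlyOne (true ∷ false ∷ []) c ≡ isEmpty (Vec.tabulate (q ∘ c))
      exactlyOne-seen {zero}  c = refl
      exactlyOne-seen {suc N} c with q (c zero)
      ... | true  = exactlyOne-failed true (c ∘ suc)
      ... | false = exactlyOne-seen (c ∘ suc)

      exactlyOne-unseen : ∀ {N} (c : Fin N → G) →
                          run-exactlyOne (false ∷ false ∷ []) c ≡ isSingleton (Vec.tabulate (q ∘ c))
      exactlyOne-unseen {zero}  c = refl
      exactlyOne-unseen {suc N} c with q (c zero)
      ... | true  = exactlyOne-seen (c ∘ suc)
      ... | false = exactlyOne-unseen (c ∘ suc)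

    accepts-exactlyOne : ∀ {N} (c : Fin N → G) → accepts exactlyOne (tabulate c) ≡ isSingleton (Vec.tabulate (q ∘ c))
    accepts-exactlyOne = exactlyOne-unseen

    accepts-exactlyOne-writeTrack : ∀ (mark : Bool → G → G) → (∀ b a → q (mark b a) ≡ b) →
      ∀ {N} (b : Vec Bool N) c → accepts exactlyOne (writeTrack mark b c) ≡ isSingleton b
    accepts-exactlyOne-writeTrack mark q-mark b c = begin
      accepts exactlyOne (writeTrack mark b c)
        ≡⟨ accepts-exactlyOne (λ j → mark (lookup b j) (c j)) ⟩
      isSingleton (Vec.tabulate (λ j → q (mark (lookup b j) (c j))))
        ≡⟨ cong isSingleton (tabulate-cong (λ j → q-mark _ (c j))) ⟩
      isSingleton (Vec.tabulate (lookup b))                           ≡⟨ cong isSingleton (tabulate∘lookup b) ⟩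
      isSingleton b                                                   ∎
      where open ≡-Reasoning

  module _ {G : Set} (q₁ q₂ : G → Bool) where

    -- the state records (seen a q₁-letter, seen a q₂-letter at or after one)
    inOrder : DFA G
    inOrder = record
      { size      = 2
      ; start     = false ∷ false ∷ []
      ; next      = λ { (s ∷ f ∷ []) a → (s ∨ q₁ a) ∷ (f ∨ ((s ∨ q₁ a) ∧ q₂ a)) ∷ [] }
      ; accepting = λ { (s ∷ f ∷ []) → f } }

    private
      run-inOrder : ∀ {N} → Vec Bool 2 → (Fin N → G) → Bool
      run-inOrder q₀ c = accepting inOrder (foldl (next inOrder) q₀ (tabulate c))

      inOrder-found : ∀ s {N} (c : Fin N → G) → run-inOrder (s ∷ true ∷ []) c ≡ true
      inOrder-found s {zero}  c = refl
      inOrder-found s {suc N} c = inOrder-found (s ∨ q₁ (c zero)) (c ∘ suc)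

      inOrder-no-q₂ : ∀ s {N} (c : Fin N → G) → (∀ k → q₂ (c k) ≡ false) →
                      run-inOrder (s ∷ false ∷ []) c ≡ false
      inOrder-no-q₂ s {zero}  c none = refl
      inOrder-no-q₂ s {suc N} c none rewrite none zero | ∧-zeroʳ (s ∨ q₁ (c zero)) =
        inOrder-no-q₂ (s ∨ q₁ (c zero)) (c ∘ suc) (none ∘ suc)

      inOrder-seen : ∀ {N} (j : Fin N) c → (∀ k → q₂ (c k) ≡ lookup (singleton j) k) →
                     run-inOrder (true ∷ false ∷ []) c ≡ true
      inOrder-seen zero    c at-j rewrite at-j zero = inOrder-found true (c ∘ suc)
      inOrder-seen (suc j) c at-j rewrite at-j zero = inOrder-seen j (c ∘ suc) (at-j ∘ suc)

      after-first : ∀ {N} (c : Fin (suc N) → G) {a b} → q₁ (c zero) ≡ a → q₂ (c zero) ≡ b →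
                    run-inOrder (false ∷ false ∷ []) c ≡ run-inOrder (a ∷ (a ∧ b) ∷ []) (c ∘ suc)
      after-first c refl refl = refl

      suc≤?suc : ∀ {n} (i j : Fin n) → ⌊ suc i ≤? suc j ⌋ ≡ ⌊ i ≤? j ⌋
      suc≤?suc i j with i ≤? j | suc i ≤? suc j
      ... | yes _   | yes _          = refl
      ... | no  _   | no  _          = refl
      ... | yes i≤j | no  si≰sj      = ⊥-elim (si≰sj (s≤s i≤j))
      ... | no  i≰j | yes (s≤s i≤j) = ⊥-elim (i≰j i≤j)

    accepts-inOrder : ∀ {N} (i j : Fin N) c → (∀ k → q₁ (c k) ≡ lookup (singleton i) k) →
                      (∀ k → q₂ (c k) ≡ lookup (singleton j) k) → accepts inOrder (tabulate c) ≡ ⌊ i ≤? j ⌋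
    accepts-inOrder zero    zero    c at-i at-j =
      trans (after-first c (at-i zero) (at-j zero)) (inOrder-found true (c ∘ suc))
    accepts-inOrder zero    (suc j) c at-i at-j =
      trans (after-first c (at-i zero) (at-j zero)) (inOrder-seen j (c ∘ suc) (at-j ∘ suc))
    accepts-inOrder (suc i) zero    c at-i at-j =
      trans (after-first c (at-i zero) (at-j zero))
            (inOrder-no-q₂ false (c ∘ suc) (λ k → trans (at-j (suc k)) (lookup-replicate k false)))
    accepts-inOrder (suc i) (suc j) c at-i at-j =
      trans (after-first c (at-i zero) (at-j zero))
            (trans (accepts-inOrder i j (c ∘ suc) (at-i ∘ suc) (at-j ∘ suc)) (sym (suc≤?suc i j)))


module LinearAlgebra where

  open import Algebra.Bundles using (CommutativeRing)
  open import Data.Fin using (Fin; zero; suc; punchIn)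
  open import Data.Fin.Properties using (any?; punchIn-punchOut) renaming (_≟_ to _≟ᶠ_)
  open import Data.Nat using (zero; suc; _≤_; z≤n; s≤s)
  open import Data.Nat.Properties using (m≤n⇒m≤1+n)
  open import Data.Product using (Σ; _×_; _,_; proj₁; proj₂)
  import Data.Product as Product
  open import Data.Rational using (ℚ; 0ℚ; 1ℚ; _+_; _*_; -_; _-_; 1/_; ≢-nonZero)
  open import Data.Rational.Properties using (_≟_; +-*-commutativeRing; *-inverseʳ; *-zeroˡ; *-zeroʳ)
  open import Data.Rational.Solver using (module +-*-Solver)
  open import Data.Sum using (_⊎_; inj₁; inj₂)
  import Data.Sum as Sum
  open import Data.Vec.Functional using (Vector; _∷_; tail; removeAt; insertAt)
  open import Data.Vec.Functional.Properties using (insertAt-lookup; insertAt-punchIn)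
  open import Function using (_∘_)
  open import Relation.Binary.PropositionalEquality
  open import Relation.Nullary using (yes; no)
  open import Relation.Nullary.Decidable using (¬?; decidable-stable)
  open import Relation.Nullary.Negation using (contradiction)

  open import Algebra.Properties.Semiring.Sum (CommutativeRing.semiring +-*-commutativeRing) public
    using (sum; sum-cong-≗; sum-remove; ∑-distrib-+; ∑-comm; *-distribˡ-sum; *-distribʳ-sum; sum-replicate-zero)

  open +-*-Solver
  open ≡-Reasoning

  sum-zero : ∀ {n} (f : Vector ℚ n) → (∀ i → f i ≡ 0ℚ) → sum f ≡ 0ℚ
  sum-zero {n} f f≗0 = trans (sum-cong-≗ f≗0) (sum-replicate-zero n)

  *-cancelʳ-≡0 : ∀ a x → a ≢ 0ℚ → x * a ≡ 0ℚ → x ≡ 0ℚ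
  *-cancelʳ-≡0 a x a≢0 xa≡0 = begin
    x                ≡⟨ solve 1 (λ x → x := x :* con 1ℚ) refl x ⟩
    x * 1ℚ           ≡⟨ cong (x *_) (sym (*-inverseʳ a)) ⟩
    x * (a * 1/ a)   ≡⟨ solve 3 (λ x a b → x :* (a :* b) := (x :* a) :* b) refl x a (1/ a) ⟩
    (x * a) * 1/ a   ≡⟨ cong (_* 1/ a) xa≡0 ⟩
    0ℚ * 1/ a        ≡⟨ *-zeroˡ (1/ a) ⟩
    0ℚ               ∎
    where instance _ = ≢-nonZero a≢0

  -- The row vector c times the matrix L whose rows are the L i; for a family of
  -- vectors L this is the linear combination with coefficients c.
  infixl 7 _⋆_
  _⋆_ : ∀ {n m} → Vector ℚ n → (Fin n → Vector ℚ m) → Vector ℚ m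
  (c ⋆ L) j = sum (λ i → c i * L i j)

  ⋆-assoc : ∀ {n m l} (c : Vector ℚ n) (L : Fin n → Vector ℚ m) (M : Fin m → Vector ℚ l) j →
            (c ⋆ L ⋆ M) j ≡ (c ⋆ (λ i → L i ⋆ M)) j
  ⋆-assoc c L M j = begin
    sum (λ q → sum (λ i → c i * L i q) * M q j)
      ≡⟨ sum-cong-≗ (λ q → *-distribʳ-sum (M q j) (λ i → c i * L i q)) ⟩
    sum (λ q → sum (λ i → c i * L i q * M q j))
      ≡⟨ ∑-comm (λ q i → c i * L i q * M q j) ⟩
    sum (λ i → sum (λ q → c i * L i q * M q j))
      ≡⟨ sum-cong-≗ (λ i → sum-cong-≗ (λ q → reassoc (c i) (L i q) (M q j))) ⟩
    sum (λ i → sum (λ q → c i * (L i q * M q j)))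
      ≡⟨ sum-cong-≗ (λ i → sym (*-distribˡ-sum (c i) (λ q → L i q * M q j))) ⟩
    (c ⋆ (λ i → L i ⋆ M)) j ∎
    where
    reassoc : ∀ a b d → a * b * d ≡ a * (b * d)
    reassoc = solve 3 (λ a b d → a :* b :* d := a :* (b :* d)) refl

  IsZero : ∀ {n} → Vector ℚ n → Set
  IsZero v = ∀ j → v j ≡ 0ℚ

  Independent : ∀ {n m} → (Fin n → Vector ℚ m) → Set
  Independent L = ∀ c → IsZero (c ⋆ L) → IsZero c

  Dependent : ∀ {n m} → (Fin n → Vector ℚ m) → Set
  Dependent {n} L = Σ (Vector ℚ n) λ c → (Σ (Fin n) λ i → c i ≢ 0ℚ) × IsZero (c ⋆ L)

  InSpan : ∀ {n m} → Vector ℚ m → (Fin n → Vector ℚ m) → Set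
  InSpan {n} v L = Σ (Vector ℚ n) λ c → ∀ j → v j ≡ (c ⋆ L) j

  inSpan-trans : ∀ {n n′ m} {v : Vector ℚ m} {L : Fin n → Vector ℚ m} {L′ : Fin n′ → Vector ℚ m} →
                 InSpan v L → (∀ i → InSpan (L i) L′) → InSpan v L′
  inSpan-trans {v = v} {L} {L′} (c , v≡cL) L⊆L′ = c ⋆ d , λ j → begin
    v j                        ≡⟨ v≡cL j ⟩
    (c ⋆ L) j                  ≡⟨ sum-cong-≗ (λ i → cong (c i *_) (proj₂ (L⊆L′ i) j)) ⟩
    (c ⋆ (λ i → d i ⋆ L′)) j   ≡⟨ sym (⋆-assoc c d L′ j) ⟩
    (c ⋆ d ⋆ L′) j             ∎
    where d = λ i → proj₁ (L⊆L′ i)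

  inSpan-⋆ : ∀ {n m l} {v : Vector ℚ m} {L : Fin n → Vector ℚ m} (M : Fin m → Vector ℚ l) →
             InSpan v L → InSpan (v ⋆ M) (λ i → L i ⋆ M)
  inSpan-⋆ {v = v} {L} M (c , v≡cL) = c , λ j → begin
    (v ⋆ M) j      ≡⟨ sum-cong-≗ (λ q → cong (_* M q j) (v≡cL q)) ⟩
    (c ⋆ L ⋆ M) j  ≡⟨ ⋆-assoc c L M j ⟩
    _              ∎

  module ZeroColumn {n m} (L : Fin n → Vector ℚ (suc m)) (column≡0 : ∀ i → L i zero ≡ 0ℚ) where

    ⋆-zero : ∀ c → (c ⋆ L) zero ≡ 0ℚ
    ⋆-zero c = sum-zero _ (λ i → trans (cong (c i *_) (column≡0 i)) (*-zeroʳ (c i)))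

    dependent : Dependent (tail ∘ L) → Dependent L
    dependent (c , nonzero , c⋆L≡0) = c , nonzero , λ where
      zero    → ⋆-zero c
      (suc j) → c⋆L≡0 j

    independent : Independent (tail ∘ L) → Independent L
    independent ind c c⋆L≡0 = ind c (c⋆L≡0 ∘ suc)

  module Pivot {n m} (L : Fin (suc n) → Vector ℚ (suc m)) (p : Fin (suc n)) (a≢0 : L p zero ≢ 0ℚ) where

    private
      a = L p zero
      instance _ = ≢-nonZero a≢0

    factor : Fin n → ℚ
    factor j = L (punchIn p j) zero * 1/ a

    eliminated : Fin n → Vector ℚ (suc m)
    eliminated j k = L (punchIn p j) k - factor j * L p k

    eliminated-zero : ∀ j → eliminated j zero ≡ 0ℚ
    eliminated-zero j = begin
      b - b * 1/ a * a    ≡⟨ solve 3 (λ b d a → b :- b :* d :* a := b :- b :* (a :* d)) refl b (1/ a) a ⟩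
      b - b * (a * 1/ a)  ≡⟨ cong (λ z → b - b * z) (*-inverseʳ a) ⟩
      b - b * 1ℚ          ≡⟨ solve 1 (λ b → b :- b :* con 1ℚ := con 0ℚ) refl b ⟩
      0ℚ                  ∎
      where b = L (punchIn p j) zero

    pivotCoefficient : Vector ℚ (suc n) → ℚ
    pivotCoefficient c = c p + sum (λ j → c (punchIn p j) * factor j)

    ⋆-decompose : ∀ c k → (c ⋆ L) k ≡ pivotCoefficient c * L p k + (removeAt c p ⋆ eliminated) k
    ⋆-decompose c k = begin
      (c ⋆ L) k
        ≡⟨ sum-remove {i = p} (λ i → c i * L i k) ⟩
      c p * l + sum (λ j → c′ j * L (punchIn p j) k)
        ≡⟨ cong (c p * l +_) (sum-cong-≗ (λ j → split (c′ j) (L (punchIn p j) k) (factor j))) ⟩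
      c p * l + sum (λ j → c′ j * eliminated j k + c′ j * factor j * l)
        ≡⟨ cong (c p * l +_) (∑-distrib-+ (λ j → c′ j * eliminated j k) (λ j → c′ j * factor j * l)) ⟩
      c p * l + ((c′ ⋆ eliminated) k + sum (λ j → c′ j * factor j * l))
        ≡⟨ cong (λ z → c p * l + ((c′ ⋆ eliminated) k + z)) (sym (*-distribʳ-sum l (λ j → c′ j * factor j))) ⟩
      c p * l + ((c′ ⋆ eliminated) k + sum (λ j → c′ j * factor j) * l)
        ≡⟨ solve 4 (λ x l e s → x :* l :+ (e :+ s :* l) := (x :+ s) :* l :+ e) refl (c p) l _ _ ⟩
      pivotCoefficient c * l + (c′ ⋆ eliminated) k ∎
      where
      l : ℚ
      l = L p k
      c′ : Vector ℚ n
      c′ = removeAt c p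
      split : ∀ x y s → x * y ≡ x * (y - s * l) + x * s * l
      split x y s = solve 4 (λ x y s l → x :* y := x :* (y :- s :* l) :+ x :* s :* l) refl x y s l

    eliminated-⋆-zero : ∀ c → (c ⋆ eliminated) zero ≡ 0ℚ
    eliminated-⋆-zero c = sum-zero _ (λ j → trans (cong (c j *_) (eliminated-zero j)) (*-zeroʳ (c j)))

    dependent : Dependent (tail ∘ eliminated) → Dependent L
    dependent (c′ , (q , c′q≢0) , c′⋆E≡0) = c , (punchIn p q , c≢0) , c⋆L≡0
      where
      c = insertAt c′ p (- sum (λ j → c′ j * factor j))
      c≢0 : c (punchIn p q) ≢ 0ℚ
      c≢0 = c′q≢0 ∘ trans (sym (insertAt-punchIn c′ p _ q))
      pivot≡0 : pivotCoefficient c ≡ 0ℚ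
      pivot≡0 = begin
        c p + sum (λ j → c (punchIn p j) * factor j)
          ≡⟨ cong₂ _+_ (insertAt-lookup c′ p _) (sum-cong-≗ (λ j → cong (_* factor j) (insertAt-punchIn c′ p _ j))) ⟩
        - S + S ≡⟨ solve 1 (λ x → :- x :+ x := con 0ℚ) refl S ⟩
        0ℚ      ∎
        where S = sum (λ j → c′ j * factor j)
      c′⋆E≡0′ : IsZero (c′ ⋆ eliminated)
      c′⋆E≡0′ zero    = eliminated-⋆-zero c′
      c′⋆E≡0′ (suc k) = c′⋆E≡0 k
      c⋆L≡0 : IsZero (c ⋆ L)
      c⋆L≡0 k = begin
        (c ⋆ L) k
          ≡⟨ ⋆-decompose c k ⟩
        pivotCoefficient c * L p k + (removeAt c p ⋆ eliminated) k
          ≡⟨ cong₂ (λ x y → x * L p k + y) pivot≡0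
                   (sum-cong-≗ (λ j → cong (_* eliminated j k) (insertAt-punchIn c′ p _ j))) ⟩
        0ℚ * L p k + (c′ ⋆ eliminated) k  ≡⟨ cong₂ _+_ (*-zeroˡ (L p k)) (c′⋆E≡0′ k) ⟩
        0ℚ + 0ℚ ≡⟨⟩
        0ℚ         ∎

    module _ (ind : Independent (tail ∘ eliminated)) (c : Vector ℚ (suc n)) (c⋆L≡0 : IsZero (c ⋆ L)) where

      private
        c′ = removeAt c p

      pivotCoefficient≡0 : pivotCoefficient c ≡ 0ℚ
      pivotCoefficient≡0 = *-cancelʳ-≡0 a _ a≢0 (begin
        pivotCoefficient c * a
          ≡⟨ solve 1 (λ x → x := x :+ con 0ℚ) refl _ ⟩
        pivotCoefficient c * a + 0ℚ
          ≡⟨ cong (pivotCoefficient c * a +_) (sym (eliminated-⋆-zero c′)) ⟩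
        pivotCoefficient c * a + (c′ ⋆ eliminated) zero
          ≡⟨ sym (⋆-decompose c zero) ⟩
        (c ⋆ L) zero
          ≡⟨ c⋆L≡0 zero ⟩
        0ℚ                                                      ∎)

      removed≡0 : IsZero c′
      removed≡0 = ind c′ λ k → begin
        (c′ ⋆ eliminated) (suc k)
          ≡⟨ solve 2 (λ x l → x := con 0ℚ :* l :+ x) refl _ (L p (suc k)) ⟩
        0ℚ * L p (suc k) + (c′ ⋆ eliminated) (suc k)
          ≡⟨ cong (λ x → x * L p (suc k) + (c′ ⋆ eliminated) (suc k)) (sym pivotCoefficient≡0) ⟩
        pivotCoefficient c * L p (suc k) + (c′ ⋆ eliminated) (suc k) ≡⟨ sym (⋆-decompose c (suc k)) ⟩
        (c ⋆ L) (suc k)                                         ≡⟨ c⋆L≡0 (suc k) ⟩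
        0ℚ                                                      ∎

      pivot≡0 : c p ≡ 0ℚ
      pivot≡0 = begin
        c p                                                ≡⟨ solve 2 (λ x s → x := (x :+ s) :- s) refl (c p) S ⟩
        pivotCoefficient c - S                             ≡⟨ cong₂ _-_ pivotCoefficient≡0 S≡0 ⟩
        0ℚ - 0ℚ                                            ≡⟨ solve 0 (con 0ℚ :- con 0ℚ := con 0ℚ) refl ⟩
        0ℚ                                                 ∎
        where
        S = sum (λ j → c′ j * factor j)
        S≡0 = sum-zero _ (λ j → trans (cong (_* factor j) (removed≡0 j)) (*-zeroˡ (factor j)))

      coefficients≡0 : IsZero c
      coefficients≡0 i with i ≟ᶠ p
      ... | yes refl = pivot≡0
      ... | no i≢p   = trans (cong c (sym (punchIn-punchOut (i≢p ∘ sym)))) (removed≡0 _)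

    independent : Independent (tail ∘ eliminated) → Independent L
    independent = coefficients≡0

  -- Gaussian elimination on the first coordinate: either the first column is
  -- zero, or a pivot row clears it from the other rows; then recurse on the
  -- remaining coordinates.
  dependent⊎independent : ∀ m {n} (L : Fin n → Vector ℚ m) → Dependent L ⊎ (Independent L × n ≤ m)
  dependent⊎independent zero    {zero}  L = inj₂ ((λ _ _ ()) , z≤n)
  dependent⊎independent zero    {suc n} L = inj₁ ((λ _ → 1ℚ) , (zero , λ ()) , λ ())
  dependent⊎independent (suc m)         L with any? (λ i → ¬? (L i zero ≟ 0ℚ))
  ... | no noPivot =
    Sum.map (ZeroColumn.dependent L column≡0) (Product.map (ZeroColumn.independent L column≡0) m≤n⇒m≤1+n)
            (dependent⊎independent m (tail ∘ L))
    where column≡0 = λ i → decidable-stable (L i zero ≟ 0ℚ) (λ Lᵢ≢0 → noPivot (i , Lᵢ≢0))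
  dependent⊎independent (suc m) {suc n} L | yes (p , a≢0) =
    Sum.map (Pivot.dependent L p a≢0) (Product.map (Pivot.independent L p a≢0) s≤s)
            (dependent⊎independent m (tail ∘ Pivot.eliminated L p a≢0))

  inSpan⊎extend : ∀ {n m} (v : Vector ℚ m) (L : Fin n → Vector ℚ m) → Independent L →
                  InSpan v L ⊎ (Independent (v ∷ L) × suc n ≤ m)
  inSpan⊎extend {n} {m} v L ind with dependent⊎independent m (v ∷ L)
  ... | inj₂ extended = inj₂ extended
  ... | inj₁ (c , (i , cᵢ≢0) , c⋆vL≡0) with c zero ≟ 0ℚ
  ...   | yes c₀≡0 = contradiction (coefficients≡0 i) cᵢ≢0
    where
    tail≡0 : IsZero (tail c)
    tail≡0 = ind (tail c) λ k → trans (solve 2 (λ s x → s := con 0ℚ :* x :+ s) refl ((tail c ⋆ L) k) (v k))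
                                       (trans (cong (λ x → x * v k + (tail c ⋆ L) k) (sym c₀≡0)) (c⋆vL≡0 k))
    coefficients≡0 : IsZero c
    coefficients≡0 zero    = c₀≡0
    coefficients≡0 (suc j) = tail≡0 j
  ...   | no c₀≢0 = inj₁ (d , v≡d⋆L)
    where
    instance _ = ≢-nonZero c₀≢0
    d : Vector ℚ n
    d j = - (1/ c zero) * c (suc j)
    v≡d⋆L : ∀ k → v k ≡ (d ⋆ L) k
    v≡d⋆L k = sym (begin
      sum (λ j → - (1/ c zero) * c (suc j) * L j k)
        ≡⟨ sum-cong-≗ (λ j → solve 3 (λ a b e → a :* b :* e := a :* (b :* e)) refl (- (1/ c zero)) (c (suc j)) (L j k)) ⟩
      sum (λ j → - (1/ c zero) * (c (suc j) * L j k))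
        ≡⟨ sym (*-distribˡ-sum (- (1/ c zero)) (λ j → c (suc j) * L j k)) ⟩
      - (1/ c zero) * (tail c ⋆ L) k
        ≡⟨ cong (- (1/ c zero) *_) tail⋆L≡ ⟩
      - (1/ c zero) * - (c zero * v k)
        ≡⟨ solve 3 (λ e a x → :- e :* (:- (a :* x)) := (a :* e) :* x) refl (1/ c zero) (c zero) (v k) ⟩
      (c zero * 1/ c zero) * v k
        ≡⟨ cong (_* v k) (*-inverseʳ (c zero)) ⟩
      1ℚ * v k
        ≡⟨ solve 1 (λ x → con 1ℚ :* x := x) refl (v k) ⟩
      v k                                              ∎)
      where
      tail⋆L≡ : (tail c ⋆ L) k ≡ - (c zero * v k)
      tail⋆L≡ = begin
        (tail c ⋆ L) k                                ≡⟨ solve 2 (λ s a → s := (a :+ s) :- a) refl _ (c zero * v k) ⟩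
        (c ⋆ (v ∷ L)) k - c zero * v k                ≡⟨ cong (_- c zero * v k) (c⋆vL≡0 k) ⟩
        0ℚ - c zero * v k                             ≡⟨ solve 1 (λ a → con 0ℚ :- a := :- a) refl (c zero * v k) ⟩
        - (c zero * v k)                              ∎


module WeightedAutomata {K : Set} {_+ᴷ_ _*ᴷ_ : K → K → K} {0ᴷ 1ᴷ : K}
                        (isCommutativeSemiring : IsCommutativeSemiring _≡_ _+ᴷ_ _*ᴷ_ 0ᴷ 1ᴷ) where

  open import Algebra.Bundles using (CommutativeSemiring)
  open import Data.Bool using (Bool; true; false; not; if_then_else_)
  open import Data.Empty using (⊥)
  open import Data.Fin using (Fin; zero; suc)
  open import Data.List using (List; []; _∷_; _++_; map; concatMap; tabulate; lookup; length; foldl; cartesianProduct)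
  open import Data.Nat using (ℕ; zero; suc)
  open import Data.Product using (_×_; _,_; proj₁; proj₂)
  open import Data.Sum using (_⊎_; inj₁; inj₂)
  open import Data.Vec using (Vec; []; _∷_; replicate)
  import Data.Vec as Vec
  open import Data.Vec.Functional using (Vector)
  open import Function using (_∘_)
  open import Level using (0ℓ)
  open import Relation.Binary.PropositionalEquality

  open import Defs using (allSubsets)
  open DeterministicAutomata
  open BitVectors

  commutativeSemiring : CommutativeSemiring 0ℓ 0ℓ
  commutativeSemiring = record { isCommutativeSemiring = isCommutativeSemiring }

  open CommutativeSemiring commutativeSemiring
    using (_+_; _*_; 0#; 1#; +-assoc; +-comm; +-identityˡ; +-identityʳ; *-identityˡ; zeroˡ; zeroʳ; distribˡ; distribʳ)
  open ≡-Reasoning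

  open import Algebra.Properties.Semiring.Sum (CommutativeSemiring.semiring commutativeSemiring) public
    using (sum; sum-cong-≗; ∑-distrib-+; *-distribˡ-sum; *-distribʳ-sum; sum-replicate-zero)
  open import Algebra.Properties.CommutativeSemigroup (CommutativeSemiring.*-commutativeSemigroup commutativeSemiring)
    using () renaming (interchange to *-interchange; x∙yz≈y∙xz to *-left-commute)

  sum-zero : ∀ {n} (f : Vector K n) → (∀ i → f i ≡ 0#) → sum f ≡ 0#
  sum-zero {n} f f≗0 = trans (sum-cong-≗ f≗0) (sum-replicate-zero n)

  𝟙 : Bool → K
  𝟙 true  = 1#
  𝟙 false = 0#

  𝟙-select : ∀ s x y → 𝟙 s * x + 𝟙 (not s) * y ≡ (if s then x else y)
  𝟙-select true  x y = trans (cong₂ _+_ (*-identityˡ x) (zeroˡ y)) (+-identityʳ x)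
  𝟙-select false x y = trans (cong₂ _+_ (zeroˡ x) (*-identityˡ y)) (+-identityˡ y)

  sumOver : ∀ {a} {A : Set a} → List A → (A → K) → K
  sumOver xs f = sum (f ∘ lookup xs)

  module _ {a} {A : Set a} where

    sumOver-cong : ∀ (xs : List A) {f g : A → K} → (∀ x → f x ≡ g x) → sumOver xs f ≡ sumOver xs g
    sumOver-cong xs f≗g = sum-cong-≗ (f≗g ∘ lookup xs)

    sumOver-zero : ∀ (xs : List A) f → (∀ x → f x ≡ 0#) → sumOver xs f ≡ 0#
    sumOver-zero xs f f≗0 = sum-zero (f ∘ lookup xs) (f≗0 ∘ lookup xs)

    sumOver-+ : ∀ (xs : List A) f g → sumOver xs (λ x → f x + g x) ≡ sumOver xs f + sumOver xs g
    sumOver-+ xs f g = ∑-distrib-+ (f ∘ lookup xs) (g ∘ lookup xs)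

    sumOver-++ : ∀ (xs ys : List A) f → sumOver (xs ++ ys) f ≡ sumOver xs f + sumOver ys f
    sumOver-++ []       ys f = sym (+-identityˡ _)
    sumOver-++ (x ∷ xs) ys f = trans (cong (f x +_) (sumOver-++ xs ys f)) (sym (+-assoc _ _ _))

  module _ {a b} {A : Set a} {B : Set b} where

    sumOver-map : ∀ (g : A → B) xs f → sumOver (map g xs) f ≡ sumOver xs (f ∘ g)
    sumOver-map g []       f = refl
    sumOver-map g (x ∷ xs) f = cong (f (g x) +_) (sumOver-map g xs f)

    sumOver-concatMap : ∀ (g : A → List B) xs f → sumOver (concatMap g xs) f ≡ sumOver xs (λ x → sumOver (g x) f)
    sumOver-concatMap g []       f = refl
    sumOver-concatMap g (x ∷ xs) f =
      trans (sumOver-++ (g x) (concatMap g xs) f) (cong (sumOver (g x) f +_) (sumOver-concatMap g xs f))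

  sumOver-cartesianProduct : ∀ {a b} {A : Set a} {B : Set b} (xs : List A) (ys : List B) f g →
    sumOver (cartesianProduct xs ys) (λ p → f (proj₁ p) * g (proj₂ p)) ≡ sumOver xs f * sumOver ys g
  sumOver-cartesianProduct []       ys f g = sym (zeroˡ _)
  sumOver-cartesianProduct (x ∷ xs) ys f g = begin
    sumOver (map (x ,_) ys ++ cartesianProduct xs ys) h
      ≡⟨ sumOver-++ (map (x ,_) ys) _ h ⟩
    sumOver (map (x ,_) ys) h + sumOver (cartesianProduct xs ys) h
      ≡⟨ cong₂ _+_ (sumOver-map (x ,_) ys h) (sumOver-cartesianProduct xs ys f g) ⟩
    sumOver ys (λ y → f x * g y) + sumOver xs f * sumOver ys g
      ≡⟨ cong (_+ _) (sym (*-distribˡ-sum (f x) (g ∘ lookup ys))) ⟩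
    f x * sumOver ys g + sumOver xs f * sumOver ys g
      ≡⟨ sym (distribʳ _ _ _) ⟩
    sumOver (x ∷ xs) f * sumOver ys g ∎
    where h = λ p → f (proj₁ p) * g (proj₂ p)

  sumOver-tabulate : ∀ {a} {A : Set a} {n} (g : Fin n → A) f → sumOver (tabulate g) f ≡ sum (f ∘ g)
  sumOver-tabulate {n = zero}  g f = refl
  sumOver-tabulate {n = suc n} g f = cong (f (g zero) +_) (sumOver-tabulate (g ∘ suc) f)

  sumOver-allSubsets : ∀ n (f : Vec Bool (suc n) → K) →
    sumOver (allSubsets (suc n)) f ≡ sumOver (allSubsets n) (f ∘ (false ∷_)) + sumOver (allSubsets n) (f ∘ (true ∷_))
  sumOver-allSubsets n f = trans (sumOver-++ (map (false ∷_) (allSubsets n)) (map (true ∷_) (allSubsets n)) f)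
                                 (cong₂ _+_ (sumOver-map _ (allSubsets n) f) (sumOver-map _ (allSubsets n) f))

  sumOver-allSubsets-== : ∀ n (p : Vec Bool n) (f : Vec Bool n → K) →
                          sumOver (allSubsets n) (λ q → 𝟙 (p == q) * f q) ≡ f p
  sumOver-allSubsets-== zero    []      f = trans (+-identityʳ _) (*-identityˡ (f []))
  sumOver-allSubsets-== (suc n) (b ∷ p) f =
    trans (sumOver-allSubsets n (λ q → 𝟙 ((b ∷ p) == q) * f q)) (pick b)
    where
    vanishes : ∀ c → sumOver (allSubsets n) (λ q → 0# * f (c ∷ q)) ≡ 0#
    vanishes c = sumOver-zero (allSubsets n) _ (λ q → zeroˡ (f (c ∷ q)))
    pick : ∀ b → sumOver (allSubsets n) (λ q → 𝟙 ((b ∷ p) == (false ∷ q)) * f (false ∷ q))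
               + sumOver (allSubsets n) (λ q → 𝟙 ((b ∷ p) == (true ∷ q)) * f (true ∷ q)) ≡ f (b ∷ p)
    pick false = trans (cong₂ _+_ (sumOver-allSubsets-== n p (f ∘ (false ∷_))) (vanishes true)) (+-identityʳ _)
    pick true  = trans (cong₂ _+_ (vanishes false) (sumOver-allSubsets-== n p (f ∘ (true ∷_)))) (+-identityˡ _)

  sumOver-allSubsets-isEmpty : ∀ n (f : Vec Bool n → K) →
                               sumOver (allSubsets n) (λ b → 𝟙 (isEmpty b) * f b) ≡ f (replicate n false)
  sumOver-allSubsets-isEmpty zero    f = trans (+-identityʳ _) (*-identityˡ (f []))
  sumOver-allSubsets-isEmpty (suc n) f = begin
    sumOver (allSubsets (suc n)) (λ b → 𝟙 (isEmpty b) * f b)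
      ≡⟨ sumOver-allSubsets n (λ b → 𝟙 (isEmpty b) * f b) ⟩
    sumOver (allSubsets n) (λ b → 𝟙 (isEmpty b) * f (false ∷ b)) + sumOver (allSubsets n) (λ b → 0# * f (true ∷ b))
      ≡⟨ cong₂ _+_ (sumOver-allSubsets-isEmpty n (f ∘ (false ∷_)))
                   (sumOver-zero (allSubsets n) (λ b → 0# * f (true ∷ b)) (λ b → zeroˡ _)) ⟩
    f (replicate (suc n) false) + 0#
      ≡⟨ +-identityʳ _ ⟩
    f (replicate (suc n) false) ∎

  sumOver-allSubsets-isSingleton : ∀ n (f : Vec Bool n → K) →
                                   sumOver (allSubsets n) (λ b → 𝟙 (isSingleton b) * f b) ≡ sum (f ∘ singleton)
  sumOver-allSubsets-isSingleton zero    f = trans (+-identityʳ _) (zeroˡ (f []))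
  sumOver-allSubsets-isSingleton (suc n) f = begin
    sumOver (allSubsets (suc n)) (λ b → 𝟙 (isSingleton b) * f b)
      ≡⟨ sumOver-allSubsets n (λ b → 𝟙 (isSingleton b) * f b) ⟩
    sumOver (allSubsets n) (λ b → 𝟙 (isSingleton b) * f (false ∷ b))
      + sumOver (allSubsets n) (λ b → 𝟙 (isEmpty b) * f (true ∷ b))
      ≡⟨ cong₂ _+_ (sumOver-allSubsets-isSingleton n (f ∘ (false ∷_)))
                   (sumOver-allSubsets-isEmpty n (f ∘ (true ∷_))) ⟩
    sum (f ∘ singleton ∘ suc) + f (singleton zero)
      ≡⟨ +-comm _ _ ⟩
    sum (f ∘ singleton) ∎

  record WA (G : Set) : Set₁ where
    field
      State   : Set
      states  : List State
      initial : State → K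
      weight  : G → State → State → K
      final   : State → K

    step : (State → K) → G → State → K
    step v a t = sumOver states (λ s → v s * weight a s t)

    run : (State → K) → List G → State → K
    run = foldl step

    evalFrom : (State → K) → List G → K
    evalFrom v u = sumOver states (λ s → run v u s * final s)

    eval : List G → K
    eval = evalFrom initial

  open WA public

  module _ {G : Set} (A : WA G) where

    run-cong : ∀ {v w} → (∀ s → v s ≡ w s) → ∀ u s → run A v u s ≡ run A w u s
    run-cong v≗w []      = v≗w
    run-cong v≗w (a ∷ u) = run-cong (λ t → sumOver-cong (states A) (λ s → cong (_* weight A a s t) (v≗w s))) u

    evalFrom-cong : ∀ {v w} → (∀ s → v s ≡ w s) → ∀ u → evalFrom A v u ≡ evalFrom A w u
    evalFrom-cong v≗w u = sumOver-cong (states A) (λ s → cong (_* final A s) (run-cong v≗w u s))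

    run-+ : ∀ v w u s → run A (λ t → v t + w t) u s ≡ run A v u s + run A w u s
    run-+ v w []      s = refl
    run-+ v w (a ∷ u) s = trans (run-cong step-+ u s) (run-+ (step A v a) (step A w a) u s)
      where
      step-+ : ∀ t → step A (λ t → v t + w t) a t ≡ step A v a t + step A w a t
      step-+ t = trans (sumOver-cong (states A) (λ s → distribʳ (weight A a s t) (v s) (w s)))
                       (sumOver-+ (states A) (λ s → v s * weight A a s t) (λ s → w s * weight A a s t))

    evalFrom-+ : ∀ v w u → evalFrom A (λ t → v t + w t) u ≡ evalFrom A v u + evalFrom A w u
    evalFrom-+ v w u = trans (sumOver-cong (states A) (λ s → trans (cong (_* final A s) (run-+ v w u s)) (distribʳ _ _ _)))
                             (sumOver-+ (states A) (λ s → run A v u s * final A s) (λ s → run A w u s * final A s))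

  zeroWA : ∀ {G} → WA G
  zeroWA = record { State = ⊥ ; states = [] ; initial = λ () ; weight = λ _ () ; final = λ () }

  scale : ∀ {G} → K → WA G → WA G
  scale c A = record A { final = λ s → c * final A s }

  eval-scale : ∀ {G} c (A : WA G) u → eval (scale c A) u ≡ c * eval A u
  eval-scale c A u = begin
    sumOver (states A) (λ s → r s * (c * final A s))
      ≡⟨ sumOver-cong (states A) (λ s → *-left-commute (r s) c (final A s)) ⟩
    sumOver (states A) (λ s → c * (r s * final A s))
      ≡⟨ sym (*-distribˡ-sum c (λ i → r (lookup (states A) i) * final A (lookup (states A) i))) ⟩
    c * eval A u                                     ∎
    where r = λ s → run A (initial A) u s

  module _ {G : Set} (A B : WA G) where

    infixl 6 _⊞_
    _⊞_ : WA G
    _⊞_ = record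
      { State   = State A ⊎ State B
      ; states  = map inj₁ (states A) ++ map inj₂ (states B)
      ; initial = λ where
          (inj₁ s) → initial A s
          (inj₂ t) → initial B t
      ; weight  = λ where
          a (inj₁ s) (inj₁ t) → weight A a s t
          a (inj₂ s) (inj₂ t) → weight B a s t
          a (inj₁ s) (inj₂ t) → 0#
          a (inj₂ s) (inj₁ t) → 0#
      ; final   = λ where
          (inj₁ s) → final A s
          (inj₂ t) → final B t }

    private
      sumOver-⊞ : ∀ f → sumOver (states _⊞_) f ≡ sumOver (states A) (f ∘ inj₁) + sumOver (states B) (f ∘ inj₂)
      sumOver-⊞ f = trans (sumOver-++ (map inj₁ (states A)) (map inj₂ (states B)) f)
                          (cong₂ _+_ (sumOver-map inj₁ (states A) f) (sumOver-map inj₂ (states B) f))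

    run-⊞ˡ : ∀ v u t → run _⊞_ v u (inj₁ t) ≡ run A (v ∘ inj₁) u t
    run-⊞ˡ v []      t = refl
    run-⊞ˡ v (a ∷ u) t = trans (run-⊞ˡ (step _⊞_ v a) u t) (run-cong A step-⊞ˡ u t)
      where
      step-⊞ˡ : ∀ t → step _⊞_ v a (inj₁ t) ≡ step A (v ∘ inj₁) a t
      step-⊞ˡ t = trans (sumOver-⊞ (λ s → v s * weight _⊞_ a s (inj₁ t)))
                        (trans (cong (step A (v ∘ inj₁) a t +_)
                                     (sumOver-zero (states B) (λ s → v (inj₂ s) * 0#) (λ s → zeroʳ (v (inj₂ s)))))
                               (+-identityʳ _))

    run-⊞ʳ : ∀ v u t → run _⊞_ v u (inj₂ t) ≡ run B (v ∘ inj₂) u t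
    run-⊞ʳ v []      t = refl
    run-⊞ʳ v (a ∷ u) t = trans (run-⊞ʳ (step _⊞_ v a) u t) (run-cong B step-⊞ʳ u t)
      where
      step-⊞ʳ : ∀ t → step _⊞_ v a (inj₂ t) ≡ step B (v ∘ inj₂) a t
      step-⊞ʳ t = trans (sumOver-⊞ (λ s → v s * weight _⊞_ a s (inj₂ t)))
                        (trans (cong (_+ step B (v ∘ inj₂) a t)
                                     (sumOver-zero (states A) (λ s → v (inj₁ s) * 0#) (λ s → zeroʳ (v (inj₁ s)))))
                               (+-identityˡ _))

    eval-⊞ : ∀ u → eval _⊞_ u ≡ eval A u + eval B u
    eval-⊞ u = trans (sumOver-⊞ (λ s → run _⊞_ (initial _⊞_) u s * final _⊞_ s))
      (cong₂ _+_ (sumOver-cong (states A) (λ s → cong (_* final A s) (run-⊞ˡ (initial _⊞_) u s)))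
                 (sumOver-cong (states B) (λ s → cong (_* final B s) (run-⊞ʳ (initial _⊞_) u s))))

    infixl 7 _⊠_
    _⊠_ : WA G
    _⊠_ = record
      { State   = State A × State B
      ; states  = cartesianProduct (states A) (states B)
      ; initial = λ (s , t) → initial A s * initial B t
      ; weight  = λ a (s , t) (s′ , t′) → weight A a s s′ * weight B a t t′
      ; final   = λ (s , t) → final A s * final B t }

    run-⊠ : ∀ v w u s t → run _⊠_ (λ (s , t) → v s * w t) u (s , t) ≡ run A v u s * run B w u t
    run-⊠ v w []      s t = refl
    run-⊠ v w (a ∷ u) s t = trans (run-cong _⊠_ step-⊠ u (s , t)) (run-⊠ (step A v a) (step B w a) u s t)
      where
      step-⊠ : ∀ ((s , t) : State A × State B) → step _⊠_ (λ (s , t) → v s * w t) a (s , t) ≡ step A v a s * step B w a t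
      step-⊠ (s , t) =
        trans (sumOver-cong (states _⊠_) (λ (s′ , t′) → *-interchange (v s′) (w t′) (weight A a s′ s) (weight B a t′ t)))
              (sumOver-cartesianProduct (states A) (states B) (λ s′ → v s′ * weight A a s′ s) (λ t′ → w t′ * weight B a t′ t))

    eval-⊠ : ∀ u → eval _⊠_ u ≡ eval A u * eval B u
    eval-⊠ u = trans (sumOver-cong (states _⊠_) (λ (s , t) →
                        trans (cong (_* (final A s * final B t)) (run-⊠ (initial A) (initial B) u s t))
                              (*-interchange (rᴬ s) (rᴮ t) (final A s) (final B t))))
                     (sumOver-cartesianProduct (states A) (states B) (λ s → rᴬ s * final A s) (λ t → rᴮ t * final B t))
      where
      rᴬ = run A (initial A) u
      rᴮ = run B (initial B) u

  module _ {G : Set} (mark : Bool → G → G) (A : WA G) where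

    sumTrack : WA G
    sumTrack = record A { weight = λ a s t → weight A (mark false a) s t + weight A (mark true a) s t }

    private
      step-sumTrack : ∀ v a t → step sumTrack v a t ≡ step A v (mark false a) t + step A v (mark true a) t
      step-sumTrack v a t =
        trans (sumOver-cong (states A) (λ s → distribˡ (v s) (weight A (mark false a) s t) (weight A (mark true a) s t)))
              (sumOver-+ (states A) (λ s → v s * weight A (mark false a) s t) (λ s → v s * weight A (mark true a) s t))

    evalFrom-sumTrack : ∀ {N} v (c : Fin N → G) →
      evalFrom sumTrack v (tabulate c) ≡ sumOver (allSubsets N) (λ b → evalFrom A v (writeTrack mark b c))
    evalFrom-sumTrack {zero}  v c = sym (+-identityʳ _)
    evalFrom-sumTrack {suc N} v c = begin
      evalFrom sumTrack (step sumTrack v (c zero)) (tabulate (c ∘ suc))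
        ≡⟨ evalFrom-cong sumTrack (step-sumTrack v (c zero)) (tabulate (c ∘ suc)) ⟩
      evalFrom sumTrack (λ t → v₀ t + v₁ t) (tabulate (c ∘ suc))
        ≡⟨ evalFrom-sumTrack (λ t → v₀ t + v₁ t) (c ∘ suc) ⟩
      sumOver (allSubsets N) (λ b → evalFrom A (λ t → v₀ t + v₁ t) (marked b))
        ≡⟨ sumOver-cong (allSubsets N) (λ b → evalFrom-+ A v₀ v₁ (marked b)) ⟩
      sumOver (allSubsets N) (λ b → evalFrom A v₀ (marked b) + evalFrom A v₁ (marked b))
        ≡⟨ sumOver-+ (allSubsets N) (λ b → evalFrom A v₀ (marked b)) (λ b → evalFrom A v₁ (marked b)) ⟩
      sumOver (allSubsets N) (λ b → evalFrom A v₀ (marked b)) + sumOver (allSubsets N) (λ b → evalFrom A v₁ (marked b))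
        ≡⟨ sym (sumOver-allSubsets N (λ b → evalFrom A v (tabulate (λ i → mark (Vec.lookup b i) (c i))))) ⟩
      sumOver (allSubsets (suc N)) (λ b → evalFrom A v (tabulate (λ i → mark (Vec.lookup b i) (c i)))) ∎
      where
      v₀ = step A v (mark false (c zero))
      v₁ = step A v (mark true (c zero))
      marked : Vec Bool N → List G
      marked b = tabulate (λ i → mark (Vec.lookup b i) (c (suc i)))

    eval-sumTrack : ∀ {N} (c : Fin N → G) →
      eval sumTrack (tabulate c) ≡ sumOver (allSubsets N) (λ b → eval A (writeTrack mark b c))
    eval-sumTrack = evalFrom-sumTrack (initial A)

  module _ {G : Set} (D : DFA G) where

    fromDFA : WA G
    fromDFA = record
      { State   = Vec Bool (size D)
      ; states  = allSubsets (size D)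
      ; initial = λ q → 𝟙 (start D == q)
      ; weight  = λ a q q′ → 𝟙 (next D q a == q′)
      ; final   = 𝟙 ∘ accepting D }

    run-fromDFA : ∀ p u q → run fromDFA (λ q → 𝟙 (p == q)) u q ≡ 𝟙 (foldl (next D) p u == q)
    run-fromDFA p []      q = refl
    run-fromDFA p (a ∷ u) q =
      trans (run-cong fromDFA (λ t → sumOver-allSubsets-== (size D) p (λ q → 𝟙 (next D q a == t))) u q)
            (run-fromDFA (next D p a) u q)

    eval-fromDFA : ∀ u → eval fromDFA u ≡ 𝟙 (accepts D u)
    eval-fromDFA u = trans (sumOver-cong (states fromDFA) (λ q → cong (_* 𝟙 (accepting D q)) (run-fromDFA (start D) u q)))
                           (sumOver-allSubsets-== (size D) _ (𝟙 ∘ accepting D))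

  module _ {G : Set} (mark : Bool → G → G) (read : G → Bool) where

    sumPosition : WA G → WA G
    sumPosition A = sumTrack mark (fromDFA (exactlyOne read) ⊠ A)

    eval-sumPosition : (∀ b a → read (mark b a) ≡ b) → ∀ A {N} (c : Fin N → G) →
                       eval (sumPosition A) (tabulate c) ≡ sum (λ i → eval A (writeTrack mark (singleton i) c))
    eval-sumPosition read-mark A {N} c = begin
      eval (sumPosition A) (tabulate c)
        ≡⟨ eval-sumTrack mark (fromDFA (exactlyOne read) ⊠ A) c ⟩
      sumOver (allSubsets N) (λ b → eval (fromDFA (exactlyOne read) ⊠ A) (writeTrack mark b c))
        ≡⟨ sumOver-cong (allSubsets N) (λ b → trans (eval-⊠ (fromDFA (exactlyOne read)) A (writeTrack mark b c))
             (cong (_* eval A (writeTrack mark b c)) (trans (eval-fromDFA (exactlyOne read) (writeTrack mark b c))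
               (cong 𝟙 (accepts-exactlyOne-writeTrack read mark read-mark b c))))) ⟩
      sumOver (allSubsets N) (λ b → 𝟙 (isSingleton b) * eval A (writeTrack mark b c))
        ≡⟨ sumOver-allSubsets-isSingleton N (λ b → eval A (writeTrack mark b c)) ⟩
      sum (λ i → eval A (writeTrack mark (singleton i) c)) ∎

  -- The same automaton with its states numbered 0 … dim - 1, so that runs are
  -- vector–matrix products.
  module MatrixForm {G : Set} (A : WA G) where

    dim : ℕ
    dim = length (states A)

    state : Fin dim → State A
    state = lookup (states A)

    transition : G → Fin dim → Vector K dim
    transition a i j = weight A a (state i) (state j)

    stepᵥ : Vector K dim → G → Vector K dim
    stepᵥ v a j = sum (λ i → v i * transition a i j)

    runᵥ : Vector K dim → List G → Vector K dim
    runᵥ = foldl stepᵥ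

    runᵥ-run : ∀ {v w} → (∀ i → v i ≡ w (state i)) → ∀ u i → runᵥ v u i ≡ run A w u (state i)
    runᵥ-run v≗w []      = v≗w
    runᵥ-run v≗w (a ∷ u) = runᵥ-run (λ j → sum-cong-≗ (λ i → cong (_* transition a i j) (v≗w i))) u

    evalᵥ : List G → K
    evalᵥ u = sum (λ i → runᵥ (initial A ∘ state) u i * final A (state i))

    evalᵥ-eval : ∀ u → evalᵥ u ≡ eval A u
    evalᵥ-eval u = sum-cong-≗ (λ i → cong (_* final A (state i)) (runᵥ-run (λ _ → refl) u i))


module ZeroTest where

  open import Algebra.Bundles using (CommutativeRing)
  open import Data.Empty using (⊥-elim)
  open import Data.Fin using (Fin; zero; suc)
  open import Data.Fin.Properties using (all?)
  open import Data.List using (List; []; _∷_; _∷ʳ_; length; lookup)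
  open import Data.List.Membership.Propositional using (_∈_)
  open import Data.List.Properties using (foldl-∷ʳ)
  open import Data.List.Relation.Unary.Any using (index)
  open import Data.List.Relation.Unary.Any.Properties using (lookup-index)
  open import Data.Nat using (ℕ; zero; suc; _+_; _≤_; z≤n)
  open import Data.Nat.Properties using (+-suc; +-identityʳ; <-irrefl; ≤-trans; ≤-refl)
  open import Data.Product using (Σ; _,_; proj₁; proj₂)
  open import Data.Rational using (ℚ; 0ℚ; _*_)
  open import Data.Rational.Properties using (_≟_; +-*-commutativeRing; *-zeroʳ)
  open import Data.Sum using (_⊎_; inj₁; inj₂)
  open import Data.Vec.Functional using (Vector) renaming (_∷_ to _∷ᵥ_)
  open import Function using (_∘_)
  open import Relation.Binary.PropositionalEquality
  open import Relation.Nullary using (Dec; yes; no)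

  open LinearAlgebra

  module ℚ-WA = WeightedAutomata (CommutativeRing.isCommutativeSemiring +-*-commutativeRing)
  open ℚ-WA using (WA; eval; initial; final; module MatrixForm)

  open ≡-Reasoning

  all⊎witness : ∀ n {p q} {P : Fin n → Set p} {Q : Set q} → (∀ i → P i ⊎ Q) → (∀ i → P i) ⊎ Q
  all⊎witness zero    P⊎Q = inj₁ λ ()
  all⊎witness (suc n) P⊎Q with P⊎Q zero | all⊎witness n (P⊎Q ∘ suc)
  ... | inj₂ q  | _        = inj₂ q
  ... | inj₁ _  | inj₂ q   = inj₂ q
  ... | inj₁ p₀ | inj₁ all = inj₁ λ where
    zero    → p₀
    (suc i) → all i

  independent-≗ : ∀ {n m} {L L′ : Fin n → Vector ℚ m} → (∀ i j → L i j ≡ L′ i j) →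
                  Independent L → Independent L′
  independent-≗ L≗L′ ind c c⋆L′≡0 = ind c λ k → trans (sum-cong-≗ (λ i → cong (c i *_) (L≗L′ i k))) (c⋆L′≡0 k)

  -- Schützenberger's algorithm: grow an independent family of reachable
  -- vectors until its span is closed under all letters; then the automaton is
  -- zero iff it vanishes on the words reaching that family.
  module _ {G : Set} (alphabet : List G) (complete : ∀ a → a ∈ alphabet) (A : WA G) where

    open MatrixForm A

    reach : List G → Vector ℚ dim
    reach = runᵥ (initial A ∘ state)

    record Basis : Set where
      field
        size        : ℕ
        words       : Fin size → List G
        independent : Independent (reach ∘ words)
        bounded     : size ≤ dim

    open Basis

    Spanned : Basis → Vector ℚ dim → Set
    Spanned b v = InSpan v (reach ∘ words b)

    record Closed (b : Basis) : Set where
      field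
        start-spanned : Spanned b (reach [])
        step-spanned  : ∀ i a → Spanned b (stepᵥ (reach (words b i)) a)

    extend : (b : Basis) (w : List G) → Independent (reach w ∷ᵥ (reach ∘ words b)) → suc (size b) ≤ dim → Basis
    extend b w ind bound = record
      { size        = suc (size b)
      ; words       = w ∷ᵥ words b
      ; independent = independent-≗ {L = reach w ∷ᵥ (reach ∘ words b)} {L′ = reach ∘ (w ∷ᵥ words b)}
                                    (λ { zero j → refl ; (suc i) j → refl }) ind
      ; bounded     = bound }

    Growth : Basis → Set
    Growth b = Σ Basis λ b′ → size b′ ≡ suc (size b)

    grow : ∀ b → Closed b ⊎ Growth b
    grow b with inSpan⊎extend (reach []) (reach ∘ words b) (independent b)
    ... | inj₂ (ind , bound) = inj₂ (extend b [] ind bound , refl)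
    ... | inj₁ start∈
      with all⊎witness (size b) (λ i → all⊎witness (length alphabet) (λ k → next∈⊎growth i (lookup alphabet k)))
      where
      next∈⊎growth : ∀ i a → Spanned b (stepᵥ (reach (words b i)) a) ⊎ Growth b
      next∈⊎growth i a with inSpan⊎extend (stepᵥ (reach (words b i)) a) (reach ∘ words b) (independent b)
      ... | inj₁ next∈         = inj₁ next∈
      ... | inj₂ (ind , bound) = inj₂ (extend b (words b i ∷ʳ a) (independent-≗ reach-∷ʳ ind) bound , refl)
        where
        reach-∷ʳ : ∀ i′ j → (stepᵥ (reach (words b i)) a ∷ᵥ (reach ∘ words b)) i′ j
                          ≡ (reach (words b i ∷ʳ a) ∷ᵥ (reach ∘ words b)) i′ j
        reach-∷ʳ zero    j = sym (cong (λ v → v j) (foldl-∷ʳ stepᵥ (initial A ∘ state) a (words b i)))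
        reach-∷ʳ (suc i′) j = refl
    ...   | inj₂ growth = inj₂ growth
    ...   | inj₁ next∈  = inj₁ record
      { start-spanned = start∈
      ; step-spanned  = λ i a → subst (λ a → Spanned b (stepᵥ (reach (words b i)) a))
                                      (sym (lookup-index (complete a))) (next∈ i (index (complete a))) }

    saturate : ∀ fuel b → dim ≤ size b + fuel → Σ Basis Closed
    saturate zero b dim≤ with grow b
    ... | inj₁ closed     = b , closed
    ... | inj₂ (b′ , refl) =
      ⊥-elim (<-irrefl refl (≤-trans (bounded b′) (subst (dim ≤_) (+-identityʳ (size b)) dim≤)))
    saturate (suc fuel) b dim≤ with grow b
    ... | inj₁ closed     = b , closed
    ... | inj₂ (b′ , refl) = saturate fuel b′ (subst (dim ≤_) (+-suc (size b) fuel) dim≤)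

    module _ (b : Basis) (closed : Closed b) where

      open Closed closed

      runᵥ-spanned : ∀ v → Spanned b v → ∀ u → Spanned b (runᵥ v u)
      runᵥ-spanned v v∈ []      = v∈
      runᵥ-spanned v v∈ (a ∷ u) =
        runᵥ-spanned (stepᵥ v a) (inSpan-trans (inSpan-⋆ (transition a) v∈) (λ i → step-spanned i a)) u

      vanishes-on-basis⇒zero : (∀ i → evalᵥ (words b i) ≡ 0ℚ) → ∀ u → evalᵥ u ≡ 0ℚ
      vanishes-on-basis⇒zero basis≡0 u = begin
        evalᵥ u                              ≡⟨ sum-cong-≗ (λ q → cong (_* β q) (reach≡ q)) ⟩
        (c ⋆ (reach ∘ words b) ⋆ B) zero     ≡⟨ ⋆-assoc c (reach ∘ words b) B zero ⟩
        sum (λ i → c i * evalᵥ (words b i))  ≡⟨ sum-zero _ (λ i → trans (cong (c i *_) (basis≡0 i)) (*-zeroʳ (c i))) ⟩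
        0ℚ                                   ∎
        where
        β = final A ∘ state
        B : Fin dim → Vector ℚ 1
        B q _ = β q
        c = proj₁ (runᵥ-spanned (reach []) start-spanned u)
        reach≡ = proj₂ (runᵥ-spanned (reach []) start-spanned u)

    emptyBasis : Basis
    emptyBasis = record { size = 0 ; words = λ () ; independent = λ _ _ () ; bounded = z≤n }

    isZero? : Dec (∀ u → eval A u ≡ 0ℚ)
    isZero? with saturate dim emptyBasis ≤-refl
    ... | b , closed with all? (λ i → evalᵥ (words b i) ≟ 0ℚ)
    ...   | yes basis≡0 = yes λ u → trans (sym (evalᵥ-eval u)) (vanishes-on-basis⇒zero b closed basis≡0 u)
    ...   | no  basis≢0 = no λ zero≡ → basis≢0 (λ i → trans (evalᵥ-eval (words b i)) (zero≡ (words b i)))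


module BooleanAutomata where

  open import Data.Bool using (Bool; true; false; _∧_; not; if_then_else_)
  open import Data.Bool.ListAction using (all)
  open import Data.Bool.Properties using (∨-∧-isCommutativeSemiring; ∧-identityʳ; not-involutive)
  open import Data.Fin using (Fin; zero; suc)
  open import Data.List using ([]; _∷_; foldl; tabulate; allFin)
  open import Data.Nat using (zero; suc)
  open import Data.Vec using (Vec; []; _∷_)
  import Data.Vec as Vec
  open import Data.Vec.Properties using (lookup∘tabulate)
  open import Function using (_∘_)
  open import Relation.Binary.PropositionalEquality

  open import Defs using (allSubsets)
  open BitVectors
  open DeterministicAutomata

  module 𝔹-WA = WeightedAutomata ∨-∧-isCommutativeSemiring
  open 𝔹-WA using (WA; initial; weight; final; run; eval; 𝟙; sum; sumOver; sum-cong-≗;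
                   fromDFA; eval-fromDFA; _⊠_; eval-⊠; sumTrack; eval-sumTrack; sumPosition; eval-sumPosition;
                   module MatrixForm)

  open ≡-Reasoning

  𝟙-id : ∀ b → 𝟙 b ≡ b
  𝟙-id true  = refl
  𝟙-id false = refl

  module _ {G : Set} (A : WA G) where

    open MatrixForm A using (dim; state)

    determinize : DFA G
    determinize = record
      { size      = dim
      ; start     = Vec.tabulate (initial A ∘ state)
      ; next      = λ q a → Vec.tabulate (λ j → sum (λ i → Vec.lookup q i ∧ weight A a (state i) (state j)))
      ; accepting = λ q → sum (λ i → Vec.lookup q i ∧ final A (state i)) }

    determinize-run : ∀ {q w} → (∀ i → Vec.lookup q i ≡ w (state i)) →
                      ∀ u i → Vec.lookup (foldl (next determinize) q u) i ≡ run A w u (state i)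
    determinize-run q≗w []      = q≗w
    determinize-run q≗w (a ∷ u) = determinize-run step≗ u
      where
      step≗ = λ j → trans (lookup∘tabulate _ j) (sum-cong-≗ (λ i → cong (_∧ weight A a (state i) (state j)) (q≗w i)))

    accepts-determinize : ∀ u → accepts determinize u ≡ eval A u
    accepts-determinize u =
      sum-cong-≗ (λ i → cong (_∧ final A (state i)) (determinize-run (lookup∘tabulate (initial A ∘ state)) u i))

  module _ {G : Set} where

    infixr 7 _∩_
    _∩_ : DFA G → DFA G → DFA G
    D₁ ∩ D₂ = determinize (fromDFA D₁ ⊠ fromDFA D₂)

    accepts-∩ : ∀ D₁ D₂ u → accepts (D₁ ∩ D₂) u ≡ accepts D₁ u ∧ accepts D₂ u
    accepts-∩ D₁ D₂ u = begin
      accepts (D₁ ∩ D₂) u                            ≡⟨ accepts-determinize (fromDFA D₁ ⊠ fromDFA D₂) u ⟩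
      eval (fromDFA D₁ ⊠ fromDFA D₂) u               ≡⟨ eval-⊠ (fromDFA D₁) (fromDFA D₂) u ⟩
      eval (fromDFA D₁) u ∧ eval (fromDFA D₂) u      ≡⟨ cong₂ _∧_ (eval-fromDFA D₁ u) (eval-fromDFA D₂ u) ⟩
      𝟙 (accepts D₁ u) ∧ 𝟙 (accepts D₂ u)            ≡⟨ cong₂ _∧_ (𝟙-id (accepts D₁ u)) (𝟙-id (accepts D₂ u)) ⟩
      accepts D₁ u ∧ accepts D₂ u                    ∎

    select : DFA G → DFA G → DFA G → DFA G
    select D D₁ D₂ = complement (complement (D ∩ D₁) ∩ complement (complement D ∩ D₂))

    accepts-select : ∀ D D₁ D₂ u →
                     accepts (select D D₁ D₂) u ≡ (if accepts D u then accepts D₁ u else accepts D₂ u)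
    accepts-select D D₁ D₂ u
      rewrite accepts-∩ (complement (D ∩ D₁)) (complement (complement D ∩ D₂)) u
            | accepts-∩ D D₁ u | accepts-∩ (complement D) D₂ u
      with accepts D u
    ... | true  = trans (cong not (∧-identityʳ _)) (not-involutive _)
    ... | false = not-involutive _

    existsTrack : (Bool → G → G) → DFA G → DFA G
    existsTrack mark D = determinize (sumTrack mark (fromDFA D))

    accepts-existsTrack : ∀ mark D {N} (c : Fin N → G) →
                          accepts (existsTrack mark D) (tabulate c)
                            ≡ sumOver (allSubsets N) (λ b → accepts D (writeTrack mark b c))
    accepts-existsTrack mark D {N} c = begin
      accepts (existsTrack mark D) (tabulate c)
        ≡⟨ accepts-determinize (sumTrack mark (fromDFA D)) (tabulate c) ⟩
      eval (sumTrack mark (fromDFA D)) (tabulate c)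
        ≡⟨ eval-sumTrack mark (fromDFA D) c ⟩
      sumOver (allSubsets N) (λ b → eval (fromDFA D) (writeTrack mark b c))
        ≡⟨ 𝔹-WA.sumOver-cong (allSubsets N) (λ b → trans (eval-fromDFA D (writeTrack mark b c)) (𝟙-id _)) ⟩
      sumOver (allSubsets N) (λ b → accepts D (writeTrack mark b c)) ∎

    existsPosition : (Bool → G → G) → (G → Bool) → DFA G → DFA G
    existsPosition mark read D = determinize (sumPosition mark read (fromDFA D))

    accepts-existsPosition : ∀ mark read → (∀ b a → read (mark b a) ≡ b) → ∀ D {N} (c : Fin N → G) →
                             accepts (existsPosition mark read D) (tabulate c)
                               ≡ sum (λ i → accepts D (writeTrack mark (singleton i) c))
    accepts-existsPosition mark read read-mark D c = begin
      accepts (existsPosition mark read D) (tabulate c)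
        ≡⟨ accepts-determinize (sumPosition mark read (fromDFA D)) (tabulate c) ⟩
      eval (sumPosition mark read (fromDFA D)) (tabulate c)
        ≡⟨ eval-sumPosition mark read read-mark (fromDFA D) c ⟩
      sum (λ i → eval (fromDFA D) (writeTrack mark (singleton i) c))
        ≡⟨ sum-cong-≗ (λ i → trans (eval-fromDFA D (writeTrack mark (singleton i) c)) (𝟙-id _)) ⟩
      sum (λ i → accepts D (writeTrack mark (singleton i) c)) ∎

  all≡not-any : ∀ {a} {A : Set a} (f : A → Bool) xs → all f xs ≡ not (sumOver xs (not ∘ f))
  all≡not-any f []       = refl
  all≡not-any f (x ∷ xs) with f x
  ... | true  = all≡not-any f xs
  ... | false = refl

  all-allFin : ∀ {N} (f : Fin N → Bool) → all f (allFin N) ≡ not (sum (not ∘ f))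
  all-allFin {N} f = trans (all≡not-any f (allFin N)) (cong not (𝔹-WA.sumOver-tabulate (λ i → i) (not ∘ f)))


module Multisets where

  open import Data.Bool using (true; false; if_then_else_)
  open import Data.Empty using (⊥-elim)
  open import Data.List using (List; []; _∷_; _++_)
  open import Data.List.Membership.Propositional using (_∈_)
  open import Data.List.Membership.Propositional.Properties using (∈-∃++)
  open import Data.List.Relation.Binary.Permutation.Propositional using (_↭_; refl; prep; swap; trans; ↭-sym)
  open import Data.List.Relation.Binary.Permutation.Propositional.Properties using (shift)
  open import Data.List.Relation.Unary.All as All using (All)
  open import Data.List.Relation.Unary.Any using (here; there)
  open import Data.Nat using (ℕ; zero; suc; _<_; s≤s)
  open import Data.Nat.Properties using (suc-injective; <-cmp; m≤n⇒m<n∨m≡n)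
  open import Data.Product using (proj₁; proj₂)
  open import Data.Rational using (ℚ; 0ℚ; 1ℚ; _+_) renaming (_<_ to _<ℚ_)
  open import Data.Rational.Properties using (_<?_; +-mono-<-≤; ≤-refl; <-trans; <-irrefl; +-identityˡ)
  open import Data.Sum using (inj₁; inj₂)
  open import Data.Unit using (tt)
  open import Function using (_∘′_)
  open import Relation.Binary using (tri<; tri≈; tri>)
  open import Relation.Binary.Definitions using (DecidableEquality)
  open import Relation.Binary.PropositionalEquality as ≡ using (_≡_; cong; sym; subst)
  open import Relation.Nullary using (yes; no)
  open import Relation.Nullary.Decidable using (⌊_⌋; toWitness)

  module _ {a} {A : Set a} (_≟_ : DecidableEquality A) where

    multiplicity : A → List A → ℕ
    multiplicity u []       = 0
    multiplicity u (y ∷ ys) = if ⌊ u ≟ y ⌋ then suc (multiplicity u ys) else multiplicity u ys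

    ↭⇒multiplicity≡ : ∀ {xs ys} → xs ↭ ys → ∀ u → multiplicity u xs ≡ multiplicity u ys
    ↭⇒multiplicity≡ refl          u = ≡.refl
    ↭⇒multiplicity≡ (prep x p)    u = cong (λ m → if ⌊ u ≟ x ⌋ then suc m else m) (↭⇒multiplicity≡ p u)
    ↭⇒multiplicity≡ (swap x y p)  u with ⌊ u ≟ x ⌋ | ⌊ u ≟ y ⌋
    ... | true  | true  = cong (suc ∘′ suc) (↭⇒multiplicity≡ p u)
    ... | true  | false = cong suc (↭⇒multiplicity≡ p u)
    ... | false | true  = cong suc (↭⇒multiplicity≡ p u)
    ... | false | false = ↭⇒multiplicity≡ p u
    ↭⇒multiplicity≡ (trans p q)   u = ≡.trans (↭⇒multiplicity≡ p u) (↭⇒multiplicity≡ q u)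

    multiplicity-self : ∀ x xs → multiplicity x (x ∷ xs) ≡ suc (multiplicity x xs)
    multiplicity-self x xs with x ≟ x
    ... | yes _ = ≡.refl
    ... | no x≢x = ⊥-elim (x≢x ≡.refl)

    multiplicity>0⇒∈ : ∀ u xs {m} → multiplicity u xs ≡ suc m → u ∈ xs
    multiplicity>0⇒∈ u (y ∷ ys) eq with u ≟ y
    ... | yes u≡y = here u≡y
    ... | no  _   = there (multiplicity>0⇒∈ u ys eq)

    multiplicity≡⇒↭ : ∀ xs ys → (∀ u → multiplicity u xs ≡ multiplicity u ys) → xs ↭ ys
    multiplicity≡⇒↭ []       []       _    = refl
    multiplicity≡⇒↭ []       (y ∷ ys) same with ≡.trans (same y) (multiplicity-self y ys)
    ... | ()
    multiplicity≡⇒↭ (x ∷ xs) ys       same =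
      trans (prep x rest↭) (↭-sym (subst (_↭ x ∷ as ++ bs) (sym ys≡) (shift x as bs)))
      where
      x∈ys = multiplicity>0⇒∈ x ys (≡.trans (sym (same x)) (multiplicity-self x xs))
      as = proj₁ (∈-∃++ x∈ys)
      bs = proj₁ (proj₂ (∈-∃++ x∈ys))
      ys≡ = proj₂ (proj₂ (∈-∃++ x∈ys))
      same′ : ∀ u → multiplicity u xs ≡ multiplicity u (as ++ bs)
      same′ u = cancel (≡.trans (same u) (≡.trans (cong (multiplicity u) ys≡) (↭⇒multiplicity≡ (shift x as bs) u)))
        where
        cancel : multiplicity u (x ∷ xs) ≡ multiplicity u (x ∷ as ++ bs) → multiplicity u xs ≡ multiplicity u (as ++ bs)
        cancel eq with ⌊ u ≟ x ⌋
        ... | true  = suc-injective eq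
        ... | false = eq
      rest↭ = multiplicity≡⇒↭ xs (as ++ bs) same′

    multiplicity≡-on⇒↭ : ∀ {q} {Q : A → Set q} {xs ys} → All Q xs → All Q ys →
                          (∀ u → Q u → multiplicity u xs ≡ multiplicity u ys) → xs ↭ ys
    multiplicity≡-on⇒↭ {xs = xs} {ys} Qxs Qys same = multiplicity≡⇒↭ xs ys same′
      where
      same′ : ∀ u → multiplicity u xs ≡ multiplicity u ys
      same′ u with multiplicity u xs in eqˣ | multiplicity u ys in eqʸ
      ... | zero  | zero  = ≡.refl
      ... | suc _ | _     = ≡.trans (sym eqˣ) (≡.trans (same u (All.lookup Qxs (multiplicity>0⇒∈ u xs eqˣ))) eqʸ)
      ... | zero  | suc _ = ≡.trans (sym eqˣ) (≡.trans (same u (All.lookup Qys (multiplicity>0⇒∈ u ys eqʸ))) eqʸ)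

  toℚ : ℕ → ℚ
  toℚ zero    = 0ℚ
  toℚ (suc n) = 1ℚ + toℚ n

  toℚ-<-suc : ∀ n → toℚ n <ℚ toℚ (suc n)
  toℚ-<-suc n =
    subst (_<ℚ 1ℚ + toℚ n) (+-identityˡ (toℚ n)) (+-mono-<-≤ (toWitness {a? = 0ℚ <? 1ℚ} tt) (≤-refl {toℚ n}))

  toℚ-strictMono : ∀ {m n} → m < n → toℚ m <ℚ toℚ n
  toℚ-strictMono {m} {suc n} (s≤s m≤n) with m≤n⇒m<n∨m≡n m≤n
  ... | inj₁ m<n    = <-trans (toℚ-strictMono m<n) (toℚ-<-suc n)
  ... | inj₂ ≡.refl = toℚ-<-suc m

  toℚ-injective : ∀ {m n} → toℚ m ≡ toℚ n → m ≡ n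
  toℚ-injective {m} {n} eq with <-cmp m n
  ... | tri< m<n _ _ = ⊥-elim (<-irrefl eq (toℚ-strictMono m<n))
  ... | tri≈ _ m≡n _ = m≡n
  ... | tri> _ _ n<m = ⊥-elim (<-irrefl (sym eq) (toℚ-strictMono n<m))


module Variables where

  open import Data.List using (List; []; _∷_; _++_)
  open import Data.Nat using (ℕ; _⊔_)
  open import Level using (Level)

  open import Defs

  maxVarᴹ : ∀ {k} → MSO k → ℕ
  maxVarᴹ ⊤ᶠ       = 0
  maxVarᴹ (P a x)  = x
  maxVarᴹ (x ≤ᵥ y) = x ⊔ y
  maxVarᴹ (x ∈ᵥ X) = x ⊔ X
  maxVarᴹ (¬ᶠ φ)   = maxVarᴹ φ
  maxVarᴹ (φ ∧ᶠ ψ) = maxVarᴹ φ ⊔ maxVarᴹ ψ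
  maxVarᴹ (∀¹ x φ) = x ⊔ maxVarᴹ φ
  maxVarᴹ (∀² X φ) = X ⊔ maxVarᴹ φ

  module _ {ℓ : Level} {R : Set ℓ} {k : ℕ} where

    maxVarˢ : StepWMSO R k → ℕ
    maxVarˢ (wt r)        = 0
    maxVarˢ (φ ⁇ Ψ₁ ∶ Ψ₂) = maxVarᴹ φ ⊔ (maxVarˢ Ψ₁ ⊔ maxVarˢ Ψ₂)

    maxVarᶜ : CoreWMSO R k → ℕ
    maxVarᶜ 𝟘             = 0
    maxVarᶜ (Π x Ψ)       = x ⊔ maxVarˢ Ψ
    maxVarᶜ (φ ⁇ Φ₁ ∶ Φ₂) = maxVarᴹ φ ⊔ (maxVarᶜ Φ₁ ⊔ maxVarᶜ Φ₂)
    maxVarᶜ (Φ₁ ⊕ Φ₂)     = maxVarᶜ Φ₁ ⊔ maxVarᶜ Φ₂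
    maxVarᶜ (Σ¹ x Φ)      = x ⊔ maxVarᶜ Φ
    maxVarᶜ (Σ² X Φ)      = X ⊔ maxVarᶜ Φ

    weightsˢ : StepWMSO R k → List R
    weightsˢ (wt r)        = r ∷ []
    weightsˢ (φ ⁇ Ψ₁ ∶ Ψ₂) = weightsˢ Ψ₁ ++ weightsˢ Ψ₂

    weightsᶜ : CoreWMSO R k → List R
    weightsᶜ 𝟘             = []
    weightsᶜ (Π x Ψ)       = weightsˢ Ψ
    weightsᶜ (φ ⁇ Φ₁ ∶ Φ₂) = weightsᶜ Φ₁ ++ weightsᶜ Φ₂
    weightsᶜ (Φ₁ ⊕ Φ₂)     = weightsᶜ Φ₁ ++ weightsᶜ Φ₂
    weightsᶜ (Σ¹ x Φ)      = weightsᶜ Φ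
    weightsᶜ (Σ² X Φ)      = weightsᶜ Φ


-- Words over Fin k together with an assignment and an output word over Fin r
-- are encoded as single words: every letter carries the symbol, one bit per
-- first-order variable y < B (is y assigned to this position?), one bit per
-- set variable Y < B (does Y contain this position?), and the output symbol.
module Encoding (k B r : ℕ) where

  open import Data.Bool using (Bool)
  open import Data.Bool.Properties using (if-float)
  open import Data.Fin using (Fin)
  open import Data.List using (List; tabulate; allFin; cartesianProduct; cartesianProductWith)
  open import Data.List.Membership.Propositional using (_∈_)
  open import Data.List.Membership.Propositional.Properties using (∈-allFin; ∈-cartesianProduct⁺; ∈-cartesianProductWith⁺)
  open import Data.List.Properties using (tabulate-cong)
  open import Data.Nat using (_<_)
  open import Data.Nat.Properties using () renaming (_≟_ to _≟ℕ_)
  open import Data.Product using (_,_)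
  open import Data.Vec using (Vec; lookup)
  open import Relation.Binary.PropositionalEquality
  open import Relation.Nullary.Decidable using (⌊_⌋)

  open import Defs using (Assignment; fo; so; _[_↦₁_]; _[_↦₂_]; allSubsets)
  open BitVectors
  open DeterministicAutomata using (writeTrack)

  record Letter : Set where
    constructor letter
    field
      symbol : Fin k
      first  : Vec Bool B
      second : Vec Bool B
      output : Fin r

  open Letter public

  setFirst setSecond : ℕ → Bool → Letter → Letter
  setFirst  x b l = record l { first  = setBit x b (first l) }
  setSecond X b l = record l { second = setBit X b (second l) }

  readFirst readSecond : ℕ → Letter → Bool
  readFirst  x l = bit (first l) x
  readSecond X l = bit (second l) X

  readFirst-setFirst : ∀ x → x < B → ∀ b l → readFirst x (setFirst x b l) ≡ b
  readFirst-setFirst x x<B b l = bit-setBit x b (first l) x<B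

  encode : ∀ {N} → Vec (Fin k) N → Assignment N → Vec (Fin r) N → Fin N → Letter
  encode w σ v j =
    letter (lookup w j) (bits (λ y → lookup (singleton (fo σ y)) j)) (bits (λ Y → lookup (so σ Y) j)) (lookup v j)

  encoding : ∀ {N} → Vec (Fin k) N → Assignment N → Vec (Fin r) N → List Letter
  encoding w σ v = tabulate (encode w σ v)

  readFirst-encode : ∀ {N} (w : Vec (Fin k) N) σ v x → x < B →
                     ∀ j → readFirst x (encode w σ v j) ≡ lookup (singleton (fo σ x)) j
  readFirst-encode w σ v x x<B j = bit-bits (λ y → lookup (singleton (fo σ y)) j) x x<B

  readSecond-encode : ∀ {N} (w : Vec (Fin k) N) σ v X → X < B → ∀ j → readSecond X (encode w σ v j) ≡ lookup (so σ X) j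
  readSecond-encode w σ v X X<B j = bit-bits (λ Y → lookup (so σ Y) j) X X<B

  writeTrack-setFirst : ∀ {N} (w : Vec (Fin k) N) σ v x i →
                        writeTrack (setFirst x) (singleton i) (encode w σ v) ≡ encoding w (σ [ x ↦₁ i ]) v
  writeTrack-setFirst w σ v x i = tabulate-cong λ j →
    cong (λ f → letter (lookup w j) f (bits (λ Y → lookup (so σ Y) j)) (lookup v j))
         (trans (setBit-bits x _ _) (bits-cong (λ y _ → sym (if-float (λ p → lookup (singleton p) j) ⌊ y ≟ℕ x ⌋))))

  writeTrack-setSecond : ∀ {N} (w : Vec (Fin k) N) σ v X I →
                         writeTrack (setSecond X) I (encode w σ v) ≡ encoding w (σ [ X ↦₂ I ]) v
  writeTrack-setSecond w σ v X I = tabulate-cong λ j →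
    cong (λ s → letter (lookup w j) (bits (λ y → lookup (singleton (fo σ y)) j)) s (lookup v j))
         (trans (setBit-bits X _ _) (bits-cong (λ Y _ → sym (if-float (λ p → lookup p j) ⌊ Y ≟ℕ X ⌋))))

  letters : List Letter
  letters = cartesianProductWith (λ (s , f) (g , o) → letter s f g o)
                                 (cartesianProduct (allFin k) (allSubsets B)) (cartesianProduct (allSubsets B) (allFin r))

  letters-complete : ∀ l → l ∈ letters
  letters-complete (letter s f g o) =
    ∈-cartesianProductWith⁺ (λ (s , f) (g , o) → letter s f g o)
      (∈-cartesianProduct⁺ (∈-allFin s) (∈-allSubsets f)) (∈-cartesianProduct⁺ (∈-allSubsets g) (∈-allFin o))


module Decoding (k B r : ℕ) where

  open import Data.Bool using (Bool; true; _∧_)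
  open import Data.Fin using (Fin)
  open import Data.List using (List; []; _∷_; tabulate; length)
  import Data.List as List
  open import Data.List.Properties using (tabulate-lookup) renaming (tabulate-cong to tabulate-congₗ)
  open import Data.Nat using (zero; suc; _≤_; _<_; s≤s)
  open import Data.Nat.Properties using (≤-trans; n≤1+n; m≤n⇒m<n∨m≡n)
  open import Data.Product using (Σ; _,_)
  open import Data.Sum using (inj₁; inj₂)
  open import Data.Vec using (Vec; lookup)
  import Data.Vec as Vec
  open import Data.Vec.Properties using (lookup∘tabulate; tabulate-cong; tabulate∘lookup)
  open import Function using (_∘_)
  open import Relation.Binary.PropositionalEquality

  open import Defs using (Assignment; ⟨_,_⟩; fo)
  open BitVectors
  open DeterministicAutomata
  open BooleanAutomata using (_∩_; accepts-∩)
  open Encoding k B r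

  valid : ℕ → DFA Letter
  valid zero    = everything
  valid (suc y) = exactlyOne (readFirst y) ∩ valid y

  accepts-valid-encoding : ∀ b → b ≤ B → ∀ {N} (w : Vec (Fin k) N) σ v → accepts (valid b) (encoding w σ v) ≡ true
  accepts-valid-encoding zero    _   w σ v = refl
  accepts-valid-encoding (suc y) y<B w σ v =
    trans (accepts-∩ (exactlyOne (readFirst y)) (valid y) (encoding w σ v))
          (cong₂ _∧_ track-y (accepts-valid-encoding y (≤-trans (n≤1+n y) y<B) w σ v))
    where
    track-y : accepts (exactlyOne (readFirst y)) (encoding w σ v) ≡ true
    track-y = begin
      accepts (exactlyOne (readFirst y)) (encoding w σ v)
        ≡⟨ accepts-exactlyOne (readFirst y) (encode w σ v) ⟩
      isSingleton (Vec.tabulate (readFirst y ∘ encode w σ v))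
        ≡⟨ cong isSingleton (tabulate-cong (readFirst-encode w σ v y y<B)) ⟩
      isSingleton (Vec.tabulate (lookup (singleton (fo σ y))))
        ≡⟨ cong isSingleton (tabulate∘lookup (singleton (fo σ y))) ⟩
      isSingleton (singleton (fo σ y))
        ≡⟨ isSingleton-singleton (fo σ y) ⟩
      true ∎
      where open ≡-Reasoning

  private
    ∧-elimˡ : ∀ {a b} → a ∧ b ≡ true → a ≡ true
    ∧-elimˡ {true} _ = refl

    ∧-elimʳ : ∀ {a b} → a ∧ b ≡ true → b ≡ true
    ∧-elimʳ {true} b≡true = b≡true

  valid⇒isSingleton : ∀ b {N} (c : Fin N → Letter) → accepts (valid b) (tabulate c) ≡ true →
                      ∀ y → y < b → isSingleton (Vec.tabulate (readFirst y ∘ c)) ≡ true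
  valid⇒isSingleton (suc b) c accepted y (s≤s y≤b) with m≤n⇒m<n∨m≡n y≤b
  ... | inj₁ y<b  = valid⇒isSingleton b c (∧-elimʳ accepted′) y y<b
    where accepted′ = trans (sym (accepts-∩ (exactlyOne (readFirst b)) (valid b) (tabulate c))) accepted
  ... | inj₂ refl = trans (sym (accepts-exactlyOne (readFirst y) c)) (∧-elimˡ accepted′)
    where accepted′ = trans (sym (accepts-∩ (exactlyOne (readFirst y)) (valid y) (tabulate c))) accepted

  decode : 0 < B → ∀ u → accepts (valid B) u ≡ true →
           Σ ℕ λ n → Σ (Vec (Fin k) (suc n)) λ w → Σ (Assignment (suc n)) λ σ →
             Σ (Vec (Fin r) (suc n)) λ v → encoding w σ v ≡ u
  decode 0<B []       accepted with valid⇒isSingleton B {0} (λ ()) accepted 0 0<B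
  ... | ()
  decode 0<B (l ∷ ls) accepted = length ls , w , σ , v , trans (tabulate-congₗ encode≡) (tabulate-lookup (l ∷ ls))
    where
    c = List.lookup (l ∷ ls)
    track : ℕ → Vec Bool (suc (length ls))
    track y = Vec.tabulate (readFirst y ∘ c)
    w = Vec.tabulate (symbol ∘ c)
    v = Vec.tabulate (output ∘ c)
    σ : Assignment (suc (length ls))
    σ = ⟨ (λ y → position (track y)) , (λ Y → Vec.tabulate (readSecond Y ∘ c)) ⟩
    accepted′ : accepts (valid B) (tabulate c) ≡ true
    accepted′ = trans (cong (accepts (valid B)) (tabulate-lookup (l ∷ ls))) accepted
    letter-cong : ∀ {a a′ f f′ s s′ o o′} → a ≡ a′ → f ≡ f′ → s ≡ s′ → o ≡ o′ →
                  letter a f s o ≡ letter a′ f′ s′ o′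
    letter-cong refl refl refl refl = refl
    encode≡ : ∀ j → encode w σ v j ≡ c j
    encode≡ j = letter-cong (lookup∘tabulate (symbol ∘ c) j)
      (trans (bits-cong λ y y<B → trans (cong (λ t → lookup t j)
                                              (singleton-position (track y) (valid⇒isSingleton B c accepted′ y y<B)))
                                        (lookup∘tabulate (readFirst y ∘ c) j))
             (bits-bit (first (c j))))
      (trans (bits-cong λ Y _ → lookup∘tabulate (readSecond Y ∘ c) j) (bits-bit (second (c j))))
      (lookup∘tabulate (output ∘ c) j)


module Translation {ℓ : Level} {R : Set ℓ} (_≟R_ : DecidableEquality R) (k B : ℕ) (weights : List R) where

  open import Data.Bool using (Bool; true; false; not; _∧_; if_then_else_)
  open import Data.Bool.Properties using (if-float)
  open import Data.Fin using (Fin; zero; suc)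
  open import Data.Fin.Properties using () renaming (_≟_ to _≟ᶠ_)
  open import Data.List using ([]; _∷_; map; tabulate; length; allFin)
  import Data.List as List
  open import Data.List.Membership.Propositional using (_∈_)
  open import Data.List.Membership.Propositional.Properties using (∈-++⁺ˡ; ∈-++⁺ʳ)
  open import Data.List.Properties using (map-tabulate) renaming (≡-dec to ≡-decₗ; tabulate-cong to tabulate-congₗ)
  open import Data.List.Relation.Binary.Subset.Propositional using (_⊆_)
  open import Data.List.Relation.Unary.All using (All; []; _∷_; universal)
  open import Data.List.Relation.Unary.All.Properties using (++⁺; concat⁺; map⁺)
  open import Data.List.Relation.Unary.Any using (here; index)
  open import Data.List.Relation.Unary.Any.Properties using (lookup-index)
  open import Data.Nat using (_<_; _⊔_) renaming (zero to zeroℕ; suc to sucℕ)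
  open import Data.Nat.Properties using (m⊔n<o⇒m<o; m⊔n<o⇒n<o; ≟-diag)
  open import Data.Product using (Σ; _,_)
  open import Data.Rational using (ℚ; 1ℚ; _+_; _*_)
  open import Data.Rational.Properties using (+-identityˡ; +-identityʳ)
  import Data.Vec as Vec
  open import Data.Vec using (Vec; lookup)
  open import Data.Vec.Properties using (lookup∘tabulate)
  open import Function using (_∘_)
  open import Relation.Binary.PropositionalEquality
  open import Relation.Nullary using (yes; no)
  open import Relation.Nullary.Decidable using (⌊_⌋)

  open import Defs
  open DeterministicAutomata
  open BitVectors using (singleton)
  open BooleanAutomata
  open Encoding k B (length weights)
  open Variables
  open Multisets using (multiplicity; toℚ)
  open ZeroTest using (module ℚ-WA)
  open ℚ-WA using (WA; eval; zeroWA; _⊞_; eval-⊞; _⊠_; eval-⊠; fromDFA; eval-fromDFA;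
                   sumTrack; eval-sumTrack; sumPosition; eval-sumPosition; 𝟙; 𝟙-select; sumOver)

  open ≡-Reasoning

  _≟L_ : DecidableEquality (List R)
  _≟L_ = ≡-decₗ _≟R_

  value : Fin (length weights) → R
  value = List.lookup weights

  outputWord : ∀ {N} → Vec (Fin (length weights)) N → List R
  outputWord v = tabulate (value ∘ lookup v)

  formulaDFA : MSO k → DFA Letter
  formulaDFA ⊤ᶠ       = everything
  formulaDFA (P a x)  = markedLetter (readFirst x) (λ l → ⌊ symbol l ≟ᶠ a ⌋)
  formulaDFA (x ≤ᵥ y) = inOrder (readFirst x) (readFirst y)
  formulaDFA (x ∈ᵥ X) = markedLetter (readFirst x) (readSecond X)
  formulaDFA (¬ᶠ φ)   = complement (formulaDFA φ)
  formulaDFA (φ ∧ᶠ ψ) = formulaDFA φ ∩ formulaDFA ψ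
  formulaDFA (∀¹ x φ) = complement (existsPosition (setFirst x) (readFirst x) (complement (formulaDFA φ)))
  formulaDFA (∀² X φ) = complement (existsTrack (setSecond X) (complement (formulaDFA φ)))

  formulaDFA-correct : ∀ φ → maxVarᴹ φ < B → ∀ {N} (w : Vec (Fin k) N) σ v →
                       accepts (formulaDFA φ) (encoding w σ v) ≡ sat φ w σ
  formulaDFA-correct ⊤ᶠ       _ w σ v = refl
  formulaDFA-correct (P a x)  b w σ v = accepts-markedLetter _ _ (fo σ x) (encode w σ v) (readFirst-encode w σ v x b)
  formulaDFA-correct (x ≤ᵥ y) b w σ v =
    accepts-inOrder _ _ (fo σ x) (fo σ y) (encode w σ v) (readFirst-encode w σ v x (m⊔n<o⇒m<o x y b))
                                                         (readFirst-encode w σ v y (m⊔n<o⇒n<o x y b))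
  formulaDFA-correct (x ∈ᵥ X) b w σ v =
    trans (accepts-markedLetter _ _ (fo σ x) (encode w σ v) (readFirst-encode w σ v x (m⊔n<o⇒m<o x X b)))
          (readSecond-encode w σ v X (m⊔n<o⇒n<o x X b) (fo σ x))
  formulaDFA-correct (¬ᶠ φ)   b w σ v = cong not (formulaDFA-correct φ b w σ v)
  formulaDFA-correct (φ ∧ᶠ ψ) b w σ v =
    trans (accepts-∩ (formulaDFA φ) (formulaDFA ψ) (encoding w σ v))
          (cong₂ _∧_ (formulaDFA-correct φ (m⊔n<o⇒m<o _ _ b) w σ v) (formulaDFA-correct ψ (m⊔n<o⇒n<o _ _ b) w σ v))
  formulaDFA-correct (∀¹ x φ) b {N} w σ v = begin
    not (accepts (existsPosition (setFirst x) (readFirst x) (complement (formulaDFA φ))) (encoding w σ v))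
      ≡⟨ cong not (accepts-existsPosition (setFirst x) (readFirst x) (readFirst-setFirst x x<B)
                                          (complement (formulaDFA φ)) (encode w σ v)) ⟩
    not (𝔹-WA.sum (λ i → not (accepts (formulaDFA φ) (writeTrack (setFirst x) (singleton i) (encode w σ v)))))
      ≡⟨ cong not (𝔹-WA.sum-cong-≗ λ i → cong (not ∘ accepts (formulaDFA φ)) (writeTrack-setFirst w σ v x i)) ⟩
    not (𝔹-WA.sum (λ i → not (accepts (formulaDFA φ) (encoding w (σ [ x ↦₁ i ]) v))))
      ≡⟨ cong not (𝔹-WA.sum-cong-≗ λ i → cong not (formulaDFA-correct φ (m⊔n<o⇒n<o x _ b) w (σ [ x ↦₁ i ]) v)) ⟩
    not (𝔹-WA.sum (λ i → not (sat φ w (σ [ x ↦₁ i ]))))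
      ≡⟨ sym (all-allFin (λ i → sat φ w (σ [ x ↦₁ i ]))) ⟩
    sat (∀¹ x φ) w σ ∎
    where x<B = m⊔n<o⇒m<o x _ b
  formulaDFA-correct (∀² X φ) b {N} w σ v = begin
    not (accepts (existsTrack (setSecond X) (complement (formulaDFA φ))) (encoding w σ v))
      ≡⟨ cong not (accepts-existsTrack (setSecond X) (complement (formulaDFA φ)) (encode w σ v)) ⟩
    not (𝔹-WA.sumOver (allSubsets N) (λ I → not (accepts (formulaDFA φ) (writeTrack (setSecond X) I (encode w σ v)))))
      ≡⟨ cong not (𝔹-WA.sumOver-cong (allSubsets N) λ I →
                     cong (not ∘ accepts (formulaDFA φ)) (writeTrack-setSecond w σ v X I)) ⟩
    not (𝔹-WA.sumOver (allSubsets N) (λ I → not (accepts (formulaDFA φ) (encoding w (σ [ X ↦₂ I ]) v))))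
      ≡⟨ cong not (𝔹-WA.sumOver-cong (allSubsets N) λ I →
                     cong not (formulaDFA-correct φ (m⊔n<o⇒n<o X _ b) w (σ [ X ↦₂ I ]) v)) ⟩
    not (𝔹-WA.sumOver (allSubsets N) (λ I → not (sat φ w (σ [ X ↦₂ I ]))))
      ≡⟨ sym (all≡not-any (λ I → sat φ w (σ [ X ↦₂ I ])) (allSubsets N)) ⟩
    sat (∀² X φ) w σ ∎

  stepDFA : ℕ → StepWMSO R k → DFA Letter
  stepDFA x (wt r)        = markedLetter (readFirst x) (λ l → ⌊ value (output l) ≟R r ⌋)
  stepDFA x (φ ⁇ Ψ₁ ∶ Ψ₂) = select (formulaDFA φ) (stepDFA x Ψ₁) (stepDFA x Ψ₂)

  stepDFA-correct : ∀ x → x < B → ∀ Ψ → maxVarˢ Ψ < B → ∀ {N} (w : Vec (Fin k) N) σ v →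
                    accepts (stepDFA x Ψ) (encoding w σ v) ≡ ⌊ value (lookup v (fo σ x)) ≟R ⟦ Ψ ⟧ˢ w σ ⌋
  stepDFA-correct x x<B (wt r)        _ w σ v = accepts-markedLetter _ _ (fo σ x) (encode w σ v) (readFirst-encode w σ v x x<B)
  stepDFA-correct x x<B (φ ⁇ Ψ₁ ∶ Ψ₂) b w σ v = begin
    accepts (stepDFA x (φ ⁇ Ψ₁ ∶ Ψ₂)) (encoding w σ v)
      ≡⟨ accepts-select (formulaDFA φ) (stepDFA x Ψ₁) (stepDFA x Ψ₂) (encoding w σ v) ⟩
    (if accepts (formulaDFA φ) (encoding w σ v)
       then accepts (stepDFA x Ψ₁) (encoding w σ v) else accepts (stepDFA x Ψ₂) (encoding w σ v))
      ≡⟨ if-cong (formulaDFA-correct φ (m⊔n<o⇒m<o _ _ b) w σ v)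
                     (stepDFA-correct x x<B Ψ₁ (m⊔n<o⇒m<o _ (maxVarˢ Ψ₂) b₁₂) w σ v)
                     (stepDFA-correct x x<B Ψ₂ (m⊔n<o⇒n<o (maxVarˢ Ψ₁) _ b₁₂) w σ v) ⟩
    (if sat φ w σ then ⌊ o ≟R ⟦ Ψ₁ ⟧ˢ w σ ⌋ else ⌊ o ≟R ⟦ Ψ₂ ⟧ˢ w σ ⌋)
      ≡⟨ sym (if-float (λ r → ⌊ o ≟R r ⌋) (sat φ w σ)) ⟩
    ⌊ o ≟R ⟦ φ ⁇ Ψ₁ ∶ Ψ₂ ⟧ˢ w σ ⌋ ∎
    where
    o = value (lookup v (fo σ x))
    b₁₂ = m⊔n<o⇒n<o (maxVarᴹ φ) _ b
    if-cong : ∀ {b b′ x x′ y y′ : Bool} → b ≡ b′ → x ≡ x′ → y ≡ y′ →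
              (if b then x else y) ≡ (if b′ then x′ else y′)
    if-cong refl refl refl = refl

  tabulate-≟L : ∀ {N} (g h : Fin N → R) →
                ⌊ tabulate g ≟L tabulate h ⌋ ≡ not (𝔹-WA.sum (λ i → not ⌊ g i ≟R h i ⌋))
  tabulate-≟L {zeroℕ}  g h = refl
  tabulate-≟L {sucℕ N} g h with g zero ≟R h zero
  ... | no  _ = refl
  ... | yes _ with tabulate (g ∘ suc) ≟L tabulate (h ∘ suc) | tabulate-≟L (g ∘ suc) (h ∘ suc)
  ...   | yes _ | ih = ih
  ...   | no  _ | ih = ih

  productDFA : ℕ → StepWMSO R k → DFA Letter
  productDFA x Ψ = complement (existsPosition (setFirst x) (readFirst x) (complement (stepDFA x Ψ)))

  productDFA-correct : ∀ x Ψ → x ⊔ maxVarˢ Ψ < B → ∀ {N} (w : Vec (Fin k) N) σ v →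
                       accepts (productDFA x Ψ) (encoding w σ v)
                         ≡ ⌊ outputWord v ≟L map (λ i → ⟦ Ψ ⟧ˢ w (σ [ x ↦₁ i ])) (allFin N) ⌋
  productDFA-correct x Ψ b {N} w σ v = begin
    not (accepts (existsPosition (setFirst x) (readFirst x) (complement (stepDFA x Ψ))) (encoding w σ v))
      ≡⟨ cong not (accepts-existsPosition (setFirst x) (readFirst x) (readFirst-setFirst x x<B)
                                          (complement (stepDFA x Ψ)) (encode w σ v)) ⟩
    not (𝔹-WA.sum (λ i → not (accepts (stepDFA x Ψ) (writeTrack (setFirst x) (singleton i) (encode w σ v)))))
      ≡⟨ cong not (𝔹-WA.sum-cong-≗ λ i → cong (not ∘ accepts (stepDFA x Ψ)) (writeTrack-setFirst w σ v x i)) ⟩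
    not (𝔹-WA.sum (λ i → not (accepts (stepDFA x Ψ) (encoding w (σ [ x ↦₁ i ]) v))))
      ≡⟨ cong not (𝔹-WA.sum-cong-≗ λ i → cong not
           (trans (stepDFA-correct x x<B Ψ (m⊔n<o⇒n<o x _ b) w (σ [ x ↦₁ i ]) v)
                  (cong (λ j → ⌊ value (lookup v j) ≟R ⟦ Ψ ⟧ˢ w (σ [ x ↦₁ i ]) ⌋) (assigned i)))) ⟩
    not (𝔹-WA.sum (λ i → not ⌊ value (lookup v i) ≟R ⟦ Ψ ⟧ˢ w (σ [ x ↦₁ i ]) ⌋))
      ≡⟨ sym (tabulate-≟L (value ∘ lookup v) (λ i → ⟦ Ψ ⟧ˢ w (σ [ x ↦₁ i ]))) ⟩
    ⌊ outputWord v ≟L tabulate (λ i → ⟦ Ψ ⟧ˢ w (σ [ x ↦₁ i ])) ⌋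
      ≡⟨ cong (λ u → ⌊ outputWord v ≟L u ⌋) (sym (map-tabulate (λ i → i) (λ i → ⟦ Ψ ⟧ˢ w (σ [ x ↦₁ i ])))) ⟩
    ⌊ outputWord v ≟L map (λ i → ⟦ Ψ ⟧ˢ w (σ [ x ↦₁ i ])) (allFin N) ⌋ ∎
    where
    x<B = m⊔n<o⇒m<o x _ b
    assigned : ∀ i → fo (σ [ x ↦₁ i ]) x ≡ i
    assigned i = cong (if_then i else fo σ x) (cong ⌊_⌋ (≟-diag {x} refl))

  count : List R → List (List R) → ℚ
  count u xs = sumOver xs (λ y → 𝟙 ⌊ u ≟L y ⌋)

  count≡multiplicity : ∀ u xs → count u xs ≡ toℚ (multiplicity _≟L_ u xs)
  count≡multiplicity u []       = refl
  count≡multiplicity u (y ∷ ys) with ⌊ u ≟L y ⌋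
  ... | true  = cong (1ℚ +_) (count≡multiplicity u ys)
  ... | false = trans (+-identityˡ _) (count≡multiplicity u ys)

  coreWA : CoreWMSO R k → WA Letter
  coreWA 𝟘             = zeroWA
  coreWA (Π x Ψ)       = fromDFA (productDFA x Ψ)
  coreWA (φ ⁇ Φ₁ ∶ Φ₂) = fromDFA (formulaDFA φ) ⊠ coreWA Φ₁ ⊞ fromDFA (complement (formulaDFA φ)) ⊠ coreWA Φ₂
  coreWA (Φ₁ ⊕ Φ₂)     = coreWA Φ₁ ⊞ coreWA Φ₂
  coreWA (Σ¹ x Φ)      = sumPosition (setFirst x) (readFirst x) (coreWA Φ)
  coreWA (Σ² X Φ)      = sumTrack (setSecond X) (coreWA Φ)

  coreWA-correct : ∀ Φ → maxVarᶜ Φ < B → ∀ {N} (w : Vec (Fin k) N) σ v →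
                   eval (coreWA Φ) (encoding w σ v) ≡ count (outputWord v) (⟦ Φ ⟧ w σ)
  coreWA-correct 𝟘             b w σ v = refl
  coreWA-correct (Π x Ψ)       b w σ v =
    trans (eval-fromDFA (productDFA x Ψ) (encoding w σ v))
          (trans (cong 𝟙 (productDFA-correct x Ψ b w σ v)) (sym (+-identityʳ _)))
  coreWA-correct (φ ⁇ Φ₁ ∶ Φ₂) b w σ v = begin
    eval (coreWA (φ ⁇ Φ₁ ∶ Φ₂)) u
      ≡⟨ eval-⊞ (fromDFA (formulaDFA φ) ⊠ coreWA Φ₁) (fromDFA (complement (formulaDFA φ)) ⊠ coreWA Φ₂) u ⟩
    eval (fromDFA (formulaDFA φ) ⊠ coreWA Φ₁) u + eval (fromDFA (complement (formulaDFA φ)) ⊠ coreWA Φ₂) u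
      ≡⟨ cong₂ _+_ (eval-⊠ (fromDFA (formulaDFA φ)) (coreWA Φ₁) u)
                   (eval-⊠ (fromDFA (complement (formulaDFA φ))) (coreWA Φ₂) u) ⟩
    eval (fromDFA (formulaDFA φ)) u * eval (coreWA Φ₁) u + eval (fromDFA (complement (formulaDFA φ))) u * eval (coreWA Φ₂) u
      ≡⟨ cong₂ _+_ (cong₂ _*_ (trans (eval-fromDFA (formulaDFA φ) u) (cong 𝟙 φ-correct))
                              (coreWA-correct Φ₁ b₁ w σ v))
                   (cong₂ _*_ (trans (eval-fromDFA (complement (formulaDFA φ)) u) (cong (𝟙 ∘ not) φ-correct))
                              (coreWA-correct Φ₂ b₂ w σ v)) ⟩
    𝟙 (sat φ w σ) * count (outputWord v) (⟦ Φ₁ ⟧ w σ)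
      + 𝟙 (not (sat φ w σ)) * count (outputWord v) (⟦ Φ₂ ⟧ w σ)
      ≡⟨ 𝟙-select (sat φ w σ) _ _ ⟩
    (if sat φ w σ then count (outputWord v) (⟦ Φ₁ ⟧ w σ) else count (outputWord v) (⟦ Φ₂ ⟧ w σ))
      ≡⟨ sym (if-float (count (outputWord v)) (sat φ w σ)) ⟩
    count (outputWord v) (⟦ φ ⁇ Φ₁ ∶ Φ₂ ⟧ w σ) ∎
    where
    u = encoding w σ v
    φ-correct = formulaDFA-correct φ (m⊔n<o⇒m<o _ _ b) w σ v
    b₁ = m⊔n<o⇒m<o _ (maxVarᶜ Φ₂) (m⊔n<o⇒n<o (maxVarᴹ φ) _ b)
    b₂ = m⊔n<o⇒n<o (maxVarᶜ Φ₁) _ (m⊔n<o⇒n<o (maxVarᴹ φ) _ b)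
  coreWA-correct (Φ₁ ⊕ Φ₂)     b w σ v =
    trans (eval-⊞ (coreWA Φ₁) (coreWA Φ₂) (encoding w σ v))
          (trans (cong₂ _+_ (coreWA-correct Φ₁ (m⊔n<o⇒m<o _ _ b) w σ v) (coreWA-correct Φ₂ (m⊔n<o⇒n<o _ _ b) w σ v))
                 (sym (ℚ-WA.sumOver-++ (⟦ Φ₁ ⟧ w σ) (⟦ Φ₂ ⟧ w σ) (λ y → 𝟙 ⌊ outputWord v ≟L y ⌋))))
  coreWA-correct (Σ¹ x Φ)      b {N} w σ v = begin
    eval (sumPosition (setFirst x) (readFirst x) (coreWA Φ)) (encoding w σ v)
      ≡⟨ eval-sumPosition (setFirst x) (readFirst x) (readFirst-setFirst x (m⊔n<o⇒m<o x _ b)) (coreWA Φ) (encode w σ v) ⟩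
    ℚ-WA.sum (λ i → eval (coreWA Φ) (writeTrack (setFirst x) (singleton i) (encode w σ v)))
      ≡⟨ ℚ-WA.sum-cong-≗ (λ i → trans (cong (eval (coreWA Φ)) (writeTrack-setFirst w σ v x i))
                                       (coreWA-correct Φ (m⊔n<o⇒n<o x _ b) w (σ [ x ↦₁ i ]) v)) ⟩
    ℚ-WA.sum (λ i → count (outputWord v) (⟦ Φ ⟧ w (σ [ x ↦₁ i ])))
      ≡⟨ sym (ℚ-WA.sumOver-tabulate (λ i → i) (λ i → count (outputWord v) (⟦ Φ ⟧ w (σ [ x ↦₁ i ])))) ⟩
    sumOver (allFin N) (λ i → count (outputWord v) (⟦ Φ ⟧ w (σ [ x ↦₁ i ])))
      ≡⟨ sym (ℚ-WA.sumOver-concatMap (λ i → ⟦ Φ ⟧ w (σ [ x ↦₁ i ])) (allFin N)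
                                     (λ y → 𝟙 ⌊ outputWord v ≟L y ⌋)) ⟩
    count (outputWord v) (⟦ Σ¹ x Φ ⟧ w σ) ∎
  coreWA-correct (Σ² X Φ)      b {N} w σ v = begin
    eval (sumTrack (setSecond X) (coreWA Φ)) (encoding w σ v)
      ≡⟨ eval-sumTrack (setSecond X) (coreWA Φ) (encode w σ v) ⟩
    sumOver (allSubsets N) (λ I → eval (coreWA Φ) (writeTrack (setSecond X) I (encode w σ v)))
      ≡⟨ ℚ-WA.sumOver-cong (allSubsets N) (λ I → trans (cong (eval (coreWA Φ)) (writeTrack-setSecond w σ v X I))
                                                     (coreWA-correct Φ (m⊔n<o⇒n<o X _ b) w (σ [ X ↦₂ I ]) v)) ⟩
    sumOver (allSubsets N) (λ I → count (outputWord v) (⟦ Φ ⟧ w (σ [ X ↦₂ I ])))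
      ≡⟨ sym (ℚ-WA.sumOver-concatMap (λ I → ⟦ Φ ⟧ w (σ [ X ↦₂ I ])) (allSubsets N)
                                     (λ y → 𝟙 ⌊ outputWord v ≟L y ⌋)) ⟩
    count (outputWord v) (⟦ Σ² X Φ ⟧ w σ) ∎

  Representable : ℕ → List R → Set ℓ
  Representable N u = Σ (Vec (Fin (length weights)) N) λ v → outputWord v ≡ u

  stepValue∈weights : ∀ Ψ → weightsˢ Ψ ⊆ weights → ∀ {N} (w : Vec (Fin k) N) σ → ⟦ Ψ ⟧ˢ w σ ∈ weights
  stepValue∈weights (wt r)        ⊆w w σ = ⊆w (here refl)
  stepValue∈weights (φ ⁇ Ψ₁ ∶ Ψ₂) ⊆w w σ with sat φ w σ
  ... | true  = stepValue∈weights Ψ₁ (⊆w ∘ ∈-++⁺ˡ) w σ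
  ... | false = stepValue∈weights Ψ₂ (⊆w ∘ ∈-++⁺ʳ (weightsˢ Ψ₁)) w σ

  representable : ∀ Φ → weightsᶜ Φ ⊆ weights → ∀ {N} (w : Vec (Fin k) N) σ →
                  All (Representable N) (⟦ Φ ⟧ w σ)
  representable 𝟘             ⊆w w σ = []
  representable (Π x Ψ)       ⊆w {N} w σ = (v , outputWord≡) ∷ []
    where
    value∈ : ∀ i → ⟦ Ψ ⟧ˢ w (σ [ x ↦₁ i ]) ∈ weights
    value∈ i = stepValue∈weights Ψ ⊆w w (σ [ x ↦₁ i ])
    v = Vec.tabulate (index ∘ value∈)
    outputWord≡ : outputWord v ≡ map (λ i → ⟦ Ψ ⟧ˢ w (σ [ x ↦₁ i ])) (allFin N)
    outputWord≡ =
      trans (tabulate-congₗ λ i → trans (cong value (lookup∘tabulate (index ∘ value∈) i)) (sym (lookup-index (value∈ i))))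
                        (sym (map-tabulate (λ i → i) _))
  representable (φ ⁇ Φ₁ ∶ Φ₂) ⊆w w σ with sat φ w σ
  ... | true  = representable Φ₁ (⊆w ∘ ∈-++⁺ˡ) w σ
  ... | false = representable Φ₂ (⊆w ∘ ∈-++⁺ʳ (weightsᶜ Φ₁)) w σ
  representable (Φ₁ ⊕ Φ₂)     ⊆w w σ =
    ++⁺ (representable Φ₁ (⊆w ∘ ∈-++⁺ˡ) w σ) (representable Φ₂ (⊆w ∘ ∈-++⁺ʳ (weightsᶜ Φ₁)) w σ)
  representable (Σ¹ x Φ)      ⊆w {N} w σ =
    concat⁺ (map⁺ (universal (λ i → representable Φ ⊆w w (σ [ x ↦₁ i ])) (allFin N)))
  representable (Σ² X Φ)      ⊆w {N} w σ =
    concat⁺ (map⁺ (universal (λ I → representable Φ ⊆w w (σ [ X ↦₂ I ])) (allSubsets N)))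


module Equivalence {ℓ} {R : Set ℓ} (_≟R_ : DecidableEquality R) {k : ℕ} (Φ₁ Φ₂ : CoreWMSO R k) where
  open import Data.Bool using (true; false)
  open import Data.List using (List; _++_; length)
  open import Data.List.Membership.Propositional.Properties using (∈-++⁺ˡ; ∈-++⁺ʳ)
  open import Data.Nat using (_⊔_; _<_; s≤s; z≤n)
  open import Data.Nat.Properties using (m≤m⊔n; m≤n⊔m; ≤-refl)
  open import Data.Product using (_,_)
  open import Data.Rational using (0ℚ; 1ℚ; _+_; _*_; -_)
  open import Data.Rational.Properties using (*-identityˡ; *-zeroˡ; +-identityˡ)
  open import Data.Rational.Solver using (module +-*-Solver)
  open +-*-Solver using (solve; _:=_; _:+_; _:*_; con)
  open import Relation.Binary.PropositionalEquality
  open import Relation.Nullary.Decidable using (map′)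
  open DeterministicAutomata using (accepts)
  open Multisets using (multiplicity; ↭⇒multiplicity≡; multiplicity≡-on⇒↭; toℚ; toℚ-injective)
  open ZeroTest using (module ℚ-WA; isZero?)
  open ℚ-WA using (WA; eval; fromDFA; eval-fromDFA; _⊠_; eval-⊠; _⊞_; eval-⊞; scale; eval-scale; 𝟙)
  open Variables

  B : ℕ
  B = suc (maxVarᶜ Φ₁ ⊔ maxVarᶜ Φ₂)

  weights : List R
  weights = weightsᶜ Φ₁ ++ weightsᶜ Φ₂

  open Translation _≟R_ k B weights
  open Decoding k B (length weights)
  open Encoding k B (length weights) public using (Letter; letters; letters-complete; encoding)

  difference : WA Letter
  difference = fromDFA (valid B) ⊠ (coreWA Φ₁ ⊞ scale (- 1ℚ) (coreWA Φ₂))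

  eval-difference : ∀ u →
                    eval difference u ≡ 𝟙 (accepts (valid B) u) * (eval (coreWA Φ₁) u + - 1ℚ * eval (coreWA Φ₂) u)
  eval-difference u =
    trans (eval-⊠ (fromDFA (valid B)) (coreWA Φ₁ ⊞ scale (- 1ℚ) (coreWA Φ₂)) u)
          (cong₂ _*_ (eval-fromDFA (valid B) u)
                     (trans (eval-⊞ (coreWA Φ₁) (scale (- 1ℚ) (coreWA Φ₂)) u)
                            (cong (eval (coreWA Φ₁) u +_) (eval-scale (- 1ℚ) (coreWA Φ₂) u))))

  private
    x-y≡0⇒x≡y : ∀ x y → x + - 1ℚ * y ≡ 0ℚ → x ≡ y
    x-y≡0⇒x≡y x y x-y≡0 = begin
      x                    ≡⟨ solve 2 (λ x y → x := (x :+ con (- 1ℚ) :* y) :+ y) refl x y ⟩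
      x + - 1ℚ * y + y     ≡⟨ cong (_+ y) x-y≡0 ⟩
      0ℚ + y               ≡⟨ +-identityˡ y ⟩
      y                    ∎
      where open ≡-Reasoning

    x≡y⇒x-y≡0 : ∀ {x y} → x ≡ y → x + - 1ℚ * y ≡ 0ℚ
    x≡y⇒x-y≡0 {x} refl = solve 1 (λ x → x :+ con (- 1ℚ) :* x := con 0ℚ) refl x

  b₁ : maxVarᶜ Φ₁ < B
  b₁ = s≤s (m≤m⊔n _ _)

  b₂ : maxVarᶜ Φ₂ < B
  b₂ = s≤s (m≤n⊔m _ _)

  multiplicityᶜ : CoreWMSO R k → ∀ {N} → Vec (Fin k) N → Assignment N → Vec (Fin (length weights)) N → ℕ
  multiplicityᶜ Φ w σ v = multiplicity _≟L_ (outputWord v) (⟦ Φ ⟧ w σ)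

  eval-difference-encoding : ∀ {N} (w : Vec (Fin k) N) σ v →
    eval difference (encoding w σ v) ≡ toℚ (multiplicityᶜ Φ₁ w σ v) + - 1ℚ * toℚ (multiplicityᶜ Φ₂ w σ v)
  eval-difference-encoding w σ v = begin
    eval difference u
      ≡⟨ eval-difference u ⟩
    𝟙 (accepts (valid B) u) * (eval (coreWA Φ₁) u + - 1ℚ * eval (coreWA Φ₂) u)
      ≡⟨ cong₂ (λ b d → 𝟙 b * d) (accepts-valid-encoding B (≤-refl {B}) w σ v)
                                (cong₂ (λ x y → x + - 1ℚ * y) (eval-coreWA Φ₁ b₁) (eval-coreWA Φ₂ b₂)) ⟩
    1ℚ * (toℚ (multiplicityᶜ Φ₁ w σ v) + - 1ℚ * toℚ (multiplicityᶜ Φ₂ w σ v))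
      ≡⟨ *-identityˡ _ ⟩
    toℚ (multiplicityᶜ Φ₁ w σ v) + - 1ℚ * toℚ (multiplicityᶜ Φ₂ w σ v) ∎
    where
    open ≡-Reasoning
    u = encoding w σ v
    eval-coreWA : ∀ Φ → maxVarᶜ Φ < B → eval (coreWA Φ) u ≡ toℚ (multiplicityᶜ Φ w σ v)
    eval-coreWA Φ b = trans (coreWA-correct Φ b w σ v) (count≡multiplicity (outputWord v) (⟦ Φ ⟧ w σ))

  Equivalent : Set ℓ
  Equivalent = ∀ n (w : Vec (Fin k) (suc n)) (σ : Assignment (suc n)) → ⟦ Φ₁ ⟧ w σ ↭ ⟦ Φ₂ ⟧ w σ

  difference≡0⇒equivalent : (∀ u → eval difference u ≡ 0ℚ) → Equivalent
  difference≡0⇒equivalent difference≡0 n w σ =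
    multiplicity≡-on⇒↭ _≟L_ (representable Φ₁ ∈-++⁺ˡ w σ) (representable Φ₂ (∈-++⁺ʳ (weightsᶜ Φ₁)) w σ) same
    where
    same : ∀ u → Representable (suc n) u → multiplicity _≟L_ u (⟦ Φ₁ ⟧ w σ) ≡ multiplicity _≟L_ u (⟦ Φ₂ ⟧ w σ)
    same u (v , refl) =
      toℚ-injective (x-y≡0⇒x≡y _ _ (trans (sym (eval-difference-encoding w σ v)) (difference≡0 (encoding w σ v))))

  equivalent⇒difference≡0 : Equivalent → ∀ u → eval difference u ≡ 0ℚ
  equivalent⇒difference≡0 equivalent u with accepts (valid B) u in accepted
  ... | false = trans (eval-difference u) (trans (cong (λ b → 𝟙 b * d) accepted) (*-zeroˡ d))
    where d = eval (coreWA Φ₁) u + - 1ℚ * eval (coreWA Φ₂) u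
  ... | true with decode (s≤s z≤n) u accepted
  ...   | n , w , σ , v , refl =
    trans (eval-difference-encoding w σ v) (x≡y⇒x-y≡0 (cong toℚ (↭⇒multiplicity≡ _≟L_ (equivalent n w σ) (outputWord v))))

open import Relation.Nullary.Decidable using (map′)
open ZeroTest using (isZero?)

corollary4 : ∀ {ℓ : Level} (R : Set ℓ) → DecidableEquality R → (k : ℕ)
    → (Φ₁ Φ₂ : CoreWMSO R k)
    → Dec (∀ (n : ℕ) (w : Vec (Fin k) (suc n)) (σ : Assignment (suc n))
    → ⟦ Φ₁ ⟧ w σ ↭ ⟦ Φ₂ ⟧ w σ)
corollary4 R _≟R_ k Φ₁ Φ₂ =
  map′ difference≡0⇒equivalent equivalent⇒difference≡0 (isZero? letters letters-complete difference)
  where open Equivalence _≟R_ Φ₁ Φ₂
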